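{- Let $n\ge1$, let $L_n$ be the lattice of arithmetic progressions in $[n]$ with Möbius function $\mu_n$, let $x_1\le x_2$ be elements of $L_n$, and let $C$ be the set of elements of $L_n$ covered by $x_2$. Then $$\mu_n(x_1,x_2)=\begin{cases}(-1)^k, & \text{if } x_1 \text{ is the meet of } k \text{ elements of } C;\\ 0, & \text{if } x_1 \text{ is not a meet of elements of } C,\end{cases}$$ where the meet of the empty subset of $C$ is taken to be $x_2$.
   Context: $L_n$ is the set of all subsets of $[n]=\{1,\ldots,n\}$ that are arithmetic progressions $\{a,a+r,\ldots,a+(k-1)r\}$ ($a$, $r\ge1$, $k\ge0$ integers; including $\emptyset$, singletons and $2$-element subsets), ordered by inclusion; it is a lattice with meet equal to intersection. "The meet of $k$ elements of $C$" means the meet of a $k$-element subset of $C$. The Möbius function is defined by $\mu_n(x,x)=1$ and $\mu_n(x,y)=-\sum_{x\le z<y}\mu_n(x,z)$ for $x<y$. -}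

module Defs where

open import Data.Bool using (Bool; true; false; if_then_else_; _∨_)
open import Data.Nat using (ℕ; zero; suc; _*_; _∸_; _≤_; _<_; _≡ᵇ_; _≤ᵇ_) renaming (_+_ to _ℕ+_)
open import Data.Fin using (Fin; toℕ)
open import Data.Fin.Subset using (Subset; _⊆_; _∩_; ⊤)
open import Data.Fin.Subset.Properties using (_⊆?_)
open import Data.Vec using (tabulate)
open import Data.Vec.Properties using (≡-dec)
import Data.Bool.Properties as BoolP
open import Data.List using (List; []; _∷_; upTo; map; concatMap; filterᵇ; deduplicate; foldr; length)
open import Data.Bool.ListAction using (any)
open import Data.List.Relation.Unary.All using (All)
open import Data.List.Relation.Unary.Unique.Propositional using (Unique)
open import Data.Integer using (ℤ; +_; -_; _^_; _+_) renaming (-1ℤ to minus1)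
open import Data.Product using (Σ; _×_; ∃)
open import Data.Sum using (_⊎_)
open import Relation.Nullary using (¬_; Dec; yes; no; does)
open import Relation.Binary.PropositionalEquality using (_≡_; _≢_)

-- Subsets of [n] = {1,…,n}: position i : Fin n stands for the number toℕ i + 1.

_≟ₛ_ : ∀ {n} (x y : Subset n) → Dec (x ≡ y)
_≟ₛ_ = ≡-dec BoolP._≟_

apSet : (n a r k : ℕ) → Subset n
apSet n a r k = tabulate λ i → any (λ j → suc (toℕ i) ≡ᵇ a ℕ+ j * r) (upTo k)

InL : (n : ℕ) → Subset n → Set
InL n x = Σ ℕ λ a → Σ ℕ λ r → Σ ℕ λ k →
  (1 ≤ a) × (1 ≤ r) × (∀ j → j < k → a ℕ+ j * r ≤ n) × (x ≡ apSet n a r k)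

Lₙ : (n : ℕ) → List (Subset n)
Lₙ n = deduplicate _≟ₛ_
  (concatMap (λ a → concatMap (λ r →
     map (λ k → apSet n a r k)
       (filterᵇ (λ k → (k ≡ᵇ 0) ∨ (a ℕ+ (k ∸ 1) * r ≤ᵇ n)) (upTo (suc n))))
     (map suc (upTo n))) (map suc (upTo n)))

sumℤ : List ℤ → ℤ
sumℤ = foldr _+_ (+ 0)

-- Möbius function with fuel: μ(x,x) = 1, μ(x,y) = - Σ_{x ≤ z < y, z ∈ L_n} μ(x,z).
-- Fuel n suffices since chains in the interval [x,y] have length ≤ |y| - |x| ≤ n.
μ-fuel : (n : ℕ) → ℕ → Subset n → Subset n → ℤ
μ-fuel n f x y with x ≟ₛ y
... | yes _ = + 1
μ-fuel n zero x y | no _ = + 0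
μ-fuel n (suc f) x y | no _ =
  - sumℤ (map (μ-fuel n f x)
          (filterᵇ (λ z → if does (x ⊆? z) then
                            (if does (z ⊆? y) then
                               (if does (z ≟ₛ y) then false else true)
                             else false)
                          else false) (Lₙ n)))

μ : (n : ℕ) → Subset n → Subset n → ℤ
μ n = μ-fuel n (suc n)

CoveredBy : (n : ℕ) → Subset n → Subset n → Set
CoveredBy n y c = InL n c × c ⊆ y × c ≢ y ×
  (∀ z → InL n z → c ⊆ z → z ⊆ y → (z ≡ c) ⊎ (z ≡ y))

meetFrom : ∀ {n} → Subset n → List (Subset n) → Subset n
meetFrom y cs = foldr _∩_ y cs

sign : ℕ → ℤ
sign k = minus1 ^ k

-- By Rota's crosscut theorem for the coatoms of x₂, μ(x₁, x₂) is the sum of (−1)^|S| over the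
-- sets S of coatoms of x₂ whose meet is x₁. The coatoms of y = {a, a + r, …, a + m r} are y
-- without its last element, y without its first element, and, for each prime p dividing m,
-- the subprogression of step p r. Each coatom c misses an element of y that lies in every
-- other coatom (the last element, the first, or a + j r with j the part of m prime to p), so
-- distinct sets of coatoms have distinct meets: the only candidate S is the set of all
-- coatoms above x₁, and μ(x₁, x₂) = (−1)^|S| if its meet is x₁, and 0 otherwise.

module Submission where

open import Defs
open import Algebra.Properties.CommutativeSemigroup using (interchange)
open import Data.Bool using (Bool; true; false; if_then_else_; T; _∨_; _∧_)
open import Data.Bool.ListAction using (any; all)
open import Data.Bool.Properties using (T-≡)
open import Data.Empty using (⊥; ⊥-elim)
open import Data.Fin using (Fin; toℕ; fromℕ<)
open import Data.Fin.Properties using (toℕ-fromℕ<; toℕ-inject; toℕ-injective; all?; ¬∀⟶∃¬; ¬∀⟶∃¬-smallest)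
open import Data.Fin.Subset using (Subset; _⊆_; _⊂_; _∈_; _∉_; _∩_; ∣_∣)
open import Data.Fin.Subset.Properties
  using (_⊆?_; _∈?_; ⊆-refl; ⊆-trans; ⊆-antisym; p∩q⊆p; p∩q⊆q; x∈p∩q⁺; x∈p∩q⁻; ∩-assoc; ∩-comm;
         p⊂q⇒∣p∣<∣q∣; p⊆q⇒∣p∣≤∣q∣; ∣p∣≤n)
open import Data.Integer using (ℤ; +_; -_; _+_)
import Data.Integer as ℤ
import Data.Integer.Properties as ℤ
open import Data.List using (List; []; _∷_; map; filter; filterᵇ; _++_; length; upTo; concatMap)
open import Data.List.Extrema.Nat using (argmax; argmax-all; f[xs]≤f[argmax])
import Data.List.Membership.DecPropositional as DecMembership
open import Data.List.Membership.Propositional using (find; lose) renaming (_∈_ to _∈ₗ_)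
open import Data.List.Membership.Propositional.Properties
  using (∈-upTo⁺; ∈-upTo⁻; ∈-++⁻; ∈-map⁺; ∈-map⁻; ∈-filter⁺; ∈-filter⁻; ∈-concatMap⁺; ∈-concatMap⁻;
         ∈-deduplicate⁺; ∈-deduplicate⁻)
open import Data.List.Membership.Propositional.Properties.WithK using (unique∧set⇒bag)
open import Data.List.Relation.Binary.BagAndSetEquality using (∼bag⇒↭)
open import Data.List.Relation.Binary.Permutation.Propositional.Properties using (↭-length)
open import Data.List.Relation.Unary.All using (All; []; _∷_)
import Data.List.Relation.Unary.All as All
import Data.List.Relation.Unary.All.Properties as All
open import Data.List.Relation.Unary.Any using (here; there)
import Data.List.Relation.Unary.Any.Properties as Any
open import Data.List.Relation.Unary.Unique.Propositional using (Unique; []; _∷_)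
import Data.List.Relation.Unary.Unique.DecPropositional.Properties as Unique
import Data.List.Relation.Unary.Unique.Propositional.Properties as UniqueP
open import Data.Nat
  using (ℕ; zero; suc; _*_; _∸_; _⊓_; _≤_; _<_; _<?_; _≟_; _≡ᵇ_; _≤ᵇ_; z≤n; s≤s;
         NonZero; ≢-nonZero; >-nonZero; >-nonZero⁻¹; nonTrivial⇒n>1; n>1⇒nonTrivial)
  renaming (_+_ to _ℕ+_)
open import Data.Nat.Divisibility using (_∣_; _∣?_; divides; quotient; ∣⇒≤; ∣1⇒≡1)
open import Data.Nat.Divisibility.Core using (hasNonTrivialDivisor)
open import Data.Nat.DivMod using (_/_; m/n*n≤m; m*n/n≡m; /-monoˡ-≤)
open import Data.Nat.GCD using (gcd)
open import Data.Nat.Induction using (<-rec)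
open import Data.Nat.LCM using (lcm; m∣lcm[m,n]; n∣lcm[m,n]; lcm-least; gcd*lcm)
open import Data.Nat.Primality
  using (Prime; prime?; euclidsLemma; prime⇒irreducible; prime⇒nonTrivial; prime⇒nonZero; ¬prime[1]; ¬prime⇒composite)
open import Data.Nat.Properties
open import Data.Product using (Σ; _×_; _,_; proj₁; proj₂)
open import Data.Sum using (_⊎_; inj₁; inj₂; [_,_]′)
open import Data.Vec.Properties using ([]=⇒lookup; lookup⇒[]=; lookup∘tabulate)
open import Function using (_∘_; id; case_of_)
open import Function.Bundles using (Equivalence; mk⇔)
open import Relation.Binary.Definitions using (DecidableEquality)
open import Relation.Binary.PropositionalEquality
open import Relation.Nullary using (Dec; yes; no; does; ¬_)
open import Relation.Nullary.Decidable
  using (dec-true; dec-false; _→-dec_; _×-dec_; T?; ¬?; decidable-stable; fromWitness; toWitness; isYes)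

private
  variable
    A B : Set
    n : ℕ

∑ : List A → (A → ℤ) → ℤ
∑ l f = sumℤ (map f l)

infix 5 ∑
syntax ∑ l (λ a → e) = ∑[ a ∈ l ] e

∑-cong : (l : List A) {f g : A → ℤ} → (∀ {a} → a ∈ₗ l → f a ≡ g a) → ∑ l f ≡ ∑ l g
∑-cong []      f≡g = refl
∑-cong (a ∷ l) f≡g = cong₂ _+_ (f≡g (here refl)) (∑-cong l (f≡g ∘ there))

∑-zero : (l : List A) {f : A → ℤ} → (∀ {a} → a ∈ₗ l → f a ≡ + 0) → ∑ l f ≡ + 0
∑-zero l f≡0 = trans (∑-cong l f≡0) (∑-const0 l)
  where
  ∑-const0 : (l : List A) → ∑[ a ∈ l ] + 0 ≡ + 0
  ∑-const0 []      = refl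
  ∑-const0 (_ ∷ l) = trans (ℤ.+-identityˡ _) (∑-const0 l)

∑-distrib-+ : (l : List A) (f g : A → ℤ) → ∑[ a ∈ l ] (f a + g a) ≡ ∑ l f + ∑ l g
∑-distrib-+ []      f g = refl
∑-distrib-+ (a ∷ l) f g =
  trans (cong (_+_ (f a + g a)) (∑-distrib-+ l f g)) (interchange ℤ.+-commutativeSemigroup (f a) (g a) (∑ l f) (∑ l g))

*-distribˡ-∑ : (c : ℤ) (l : List A) (f : A → ℤ) → ∑[ a ∈ l ] (c ℤ.* f a) ≡ c ℤ.* ∑ l f
*-distribˡ-∑ c []      f = sym (ℤ.*-zeroʳ c)
*-distribˡ-∑ c (a ∷ l) f = trans (cong (_+_ (c ℤ.* f a)) (*-distribˡ-∑ c l f)) (sym (ℤ.*-distribˡ-+ c (f a) (∑ l f)))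

neg-distrib-∑ : (l : List A) (f : A → ℤ) → ∑[ a ∈ l ] (- f a) ≡ - ∑ l f
neg-distrib-∑ []      f = refl
neg-distrib-∑ (a ∷ l) f = trans (cong (_+_ (- f a)) (neg-distrib-∑ l f)) (sym (ℤ.neg-distrib-+ (f a) (∑ l f)))

∑-++ : (l m : List A) (f : A → ℤ) → ∑ (l ++ m) f ≡ ∑ l f + ∑ m f
∑-++ []      m f = sym (ℤ.+-identityˡ _)
∑-++ (a ∷ l) m f = trans (cong (_+_ (f a)) (∑-++ l m f)) (sym (ℤ.+-assoc (f a) (∑ l f) (∑ m f)))

∑-map : (l : List A) (g : A → B) (f : B → ℤ) → ∑ (map g l) f ≡ ∑[ a ∈ l ] f (g a)
∑-map []      g f = refl
∑-map (a ∷ l) g f = cong (_+_ (f (g a))) (∑-map l g f)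

∑-comm : (l : List A) (m : List B) (f : A → B → ℤ) → ∑[ a ∈ l ] ∑[ b ∈ m ] f a b ≡ ∑[ b ∈ m ] ∑[ a ∈ l ] f a b
∑-comm []      m f = sym (∑-zero m (λ _ → refl))
∑-comm (a ∷ l) m f = trans (cong (_+_ (∑ m (f a))) (∑-comm l m f)) (sym (∑-distrib-+ m (f a) (λ b → ∑[ a ∈ l ] f a b)))

∑-filter : (l : List A) (p : A → Bool) (f : A → ℤ) → ∑ (filterᵇ p l) f ≡ ∑[ a ∈ l ] (if p a then f a else + 0)
∑-filter []      p f = refl
∑-filter (a ∷ l) p f with p a
... | true  = cong (_+_ (f a)) (∑-filter l p f)
... | false = trans (∑-filter l p f) (sym (ℤ.+-identityˡ _))

module _ (_≟_ : DecidableEquality A) where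

  ∑-indicator-∉ : (l : List A) (y : A) (g : A → ℤ) → ¬ y ∈ₗ l →
    ∑[ z ∈ l ] (if does (z ≟ y) then g z else + 0) ≡ + 0
  ∑-indicator-∉ l y g y∉l = ∑-zero l λ {z} z∈l → cong (λ b → if b then g z else + 0)
    (dec-false (z ≟ y) λ { refl → y∉l z∈l })

  ∑-indicator : (l : List A) (y : A) (g : A → ℤ) → Unique l → y ∈ₗ l →
    ∑[ z ∈ l ] (if does (z ≟ y) then g z else + 0) ≡ g y
  ∑-indicator (z ∷ l) y g (z∉l ∷ _) (here refl) =
    trans (cong₂ (λ b s → (if b then g z else + 0) + s) (dec-true (z ≟ z) refl)
                 (∑-indicator-∉ l z g λ z∈l → All.lookup z∉l z∈l refl))
          (ℤ.+-identityʳ (g z))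
  ∑-indicator (z ∷ l) y g (z∉l ∷ l!) (there y∈l) with z ≟ y
  ... | yes refl = ⊥-elim (All.lookup z∉l y∈l refl)
  ... | no _     = trans (ℤ.+-identityˡ _) (∑-indicator l y g l! y∈l)

if-yes : {C P : Set} (p? : Dec P) {u v : C} → P → (if does p? then u else v) ≡ u
if-yes p? p = cong (λ b → if b then _ else _) (dec-true p? p)

if-no : {C P : Set} (p? : Dec P) {u v : C} → ¬ P → (if does p? then u else v) ≡ v
if-no p? ¬p = cong (λ b → if b then _ else _) (dec-false p? ¬p)

any-true : (p : A → Bool) {l : List A} {c : A} → c ∈ₗ l → T (p c) → any p l ≡ true
any-true p c∈l pc = Equivalence.to T-≡ (Any.any⁺ p (lose c∈l pc))

any-false : (p : A → Bool) (l : List A) → (∀ {c} → c ∈ₗ l → ¬ T (p c)) → any p l ≡ false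
any-false p l none with any p l in eq
... | false = refl
... | true with c , c∈l , pc ← find (Any.any⁻ p l (Equivalence.from T-≡ eq)) = ⊥-elim (none c∈l pc)

does-⇔ : {P : Set} (p? : Dec P) (b : Bool) → (P → T b) → (T b → P) → does p? ≡ b
does-⇔ (yes p) true  to from = refl
does-⇔ (yes p) false to from = ⊥-elim (to p)
does-⇔ (no ¬p) true  to from = ⊥-elim (¬p (from _))
does-⇔ (no ¬p) false to from = refl

if-∑ : (b : Bool) (l : List A) (f : A → ℤ) → (if b then ∑ l f else + 0) ≡ ∑[ a ∈ l ] (if b then f a else + 0)
if-∑ true  l f = refl
if-∑ false l f = sym (∑-zero l λ _ → refl)

if-if-comm : (b c : Bool) (v : ℤ) →
  (if b then (if c then v else + 0) else + 0) ≡ (if c then (if b then v else + 0) else + 0)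
if-if-comm true  c     v = refl
if-if-comm false true  v = refl
if-if-comm false false v = refl

indicator-* : {P Q R : Set} (p? : Dec P) (q? : Dec Q) (r? : Dec R) → (P × Q → R) → (R → P × Q) → (u v : ℤ) →
  (if does p? then u else + 0) ℤ.* (if does q? then v else + 0) ≡ (if does r? then u ℤ.* v else + 0)
indicator-* p? q? r? to from u v with p? | q? | r?
... | yes p | yes q | yes _ = refl
... | yes p | yes q | no ¬r = ⊥-elim (¬r (to (p , q)))
... | yes _ | no ¬q | yes r = ⊥-elim (¬q (proj₂ (from r)))
... | yes _ | no _  | no _  = ℤ.*-zeroʳ u
... | no ¬p | _     | yes r = ⊥-elim (¬p (proj₁ (from r)))
... | no _  | _     | no _  = refl

length-cong-unique : {xs ys : List A} → Unique xs → Unique ys →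
  (∀ {x} → x ∈ₗ xs → x ∈ₗ ys) → (∀ {x} → x ∈ₗ ys → x ∈ₗ xs) → length xs ≡ length ys
length-cong-unique xs! ys! xs⊆ys ys⊆xs = ↭-length (∼bag⇒↭ (unique∧set⇒bag xs! ys! (mk⇔ xs⊆ys ys⊆xs)))

⊆∧≢⇒⊂ : {p q : Subset n} → p ⊆ q → p ≢ q → p ⊂ q
⊆∧≢⇒⊂ {n} {p} {q} p⊆q p≢q
  with i , i∈q⇏i∈p ← ¬∀⟶∃¬ n (λ i → i ∈ q → i ∈ p) (λ i → i ∈? q →-dec i ∈? p)
                              (λ q⊆p → p≢q (⊆-antisym p⊆q (q⊆p _)))
  with i ∈? q | i ∈? p
... | yes i∈q | no i∉p = p⊆q , i , i∈q , i∉p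
... | no i∉q  | _      = ⊥-elim (i∈q⇏i∈p (⊥-elim ∘ i∉q))
... | _       | yes i∈p = ⊥-elim (i∈q⇏i∈p (λ _ → i∈p))

⊆∧≢⇒∣∣< : {p q : Subset n} → p ⊆ q → p ≢ q → ∣ p ∣ < ∣ q ∣
⊆∧≢⇒∣∣< p⊆q p≢q = p⊂q⇒∣p∣<∣q∣ (⊆∧≢⇒⊂ p⊆q p≢q)

between? : (x y z : Subset n) → Dec (x ⊆ z × z ⊆ y)
between? x y z = x ⊆? z ×-dec z ⊆? y

meetFrom-⊆ : (y : Subset n) (S : List (Subset n)) → meetFrom y S ⊆ y
meetFrom-⊆ y []      = λ i∈y → i∈y
meetFrom-⊆ y (c ∷ S) = ⊆-trans (p∩q⊆q c (meetFrom y S)) (meetFrom-⊆ y S)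

meetFrom-⊆-∈ : (y : Subset n) (S : List (Subset n)) {c : Subset n} → c ∈ₗ S → meetFrom y S ⊆ c
meetFrom-⊆-∈ y (c ∷ S) (here refl) = p∩q⊆p c (meetFrom y S)
meetFrom-⊆-∈ y (d ∷ S) (there c∈S) = ⊆-trans (p∩q⊆q d (meetFrom y S)) (meetFrom-⊆-∈ y S c∈S)

∈-meetFrom⁺ : (y : Subset n) (S : List (Subset n)) {i : Fin n} →
  i ∈ y → (∀ {c} → c ∈ₗ S → i ∈ c) → i ∈ meetFrom y S
∈-meetFrom⁺ y []      i∈y i∈S = i∈y
∈-meetFrom⁺ y (c ∷ S) i∈y i∈S = x∈p∩q⁺ (i∈S (here refl) , ∈-meetFrom⁺ y S i∈y (i∈S ∘ there))

⊆-meetFrom : (y : Subset n) (S : List (Subset n)) {z : Subset n} →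
  z ⊆ y → (∀ {c} → c ∈ₗ S → z ⊆ c) → z ⊆ meetFrom y S
⊆-meetFrom y S z⊆y z⊆S i∈z = ∈-meetFrom⁺ y S (z⊆y i∈z) (λ c∈S → z⊆S c∈S i∈z)

∩-meetFrom : (c y : Subset n) (S : List (Subset n)) → c ∩ meetFrom y S ≡ meetFrom (c ∩ y) S
∩-meetFrom c y []      = refl
∩-meetFrom c y (d ∷ S) = begin
  c ∩ (d ∩ meetFrom y S)   ≡⟨ sym (∩-assoc c d _) ⟩
  (c ∩ d) ∩ meetFrom y S   ≡⟨ cong (_∩ meetFrom y S) (∩-comm c d) ⟩
  (d ∩ c) ∩ meetFrom y S   ≡⟨ ∩-assoc d c _ ⟩
  d ∩ (c ∩ meetFrom y S)   ≡⟨ cong (d ∩_) (∩-meetFrom c y S) ⟩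
  d ∩ meetFrom (c ∩ y) S   ∎
  where open ≡-Reasoning

between-meetFrom : {y z : Subset n} (S : List (Subset n)) → z ⊆ y →
  does (between? z y (meetFrom y S)) ≡ all (λ c → isYes (z ⊆? c)) S
between-meetFrom {y = y} {z} S z⊆y = does-⇔ (between? z y (meetFrom y S)) (all (λ c → isYes (z ⊆? c)) S)
  (λ (z⊆meet , _) → All.all⁻ _ (All.tabulate λ {c} c∈S →
     fromWitness {a? = z ⊆? c} (⊆-trans z⊆meet (meetFrom-⊆-∈ y S c∈S))))
  (λ all-above → ⊆-meetFrom y S z⊆y (λ {c} c∈S → toWitness {a? = z ⊆? c} (All.lookup (All.all⁺ _ S all-above) c∈S))
               , meetFrom-⊆ y S)

fromValue : (v : ℕ) → 1 ≤ v → v ≤ n → Fin n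
fromValue (suc v) _ v≤n = fromℕ< v≤n

toℕ-fromValue : (v : ℕ) (1≤v : 1 ≤ v) (v≤n : v ≤ n) → suc (toℕ (fromValue v 1≤v v≤n)) ≡ v
toℕ-fromValue (suc v) _ v≤n = cong suc (toℕ-fromℕ< v≤n)

module _ (a r k : ℕ) {i : Fin n} where

  ∈-apSet⁻ : i ∈ apSet n a r k → Σ ℕ λ j → j < k × suc (toℕ i) ≡ a ℕ+ j * r
  ∈-apSet⁻ i∈ap
    with j , j∈upTo , hit ← find (Any.any⁻ _ (upTo k) (Equivalence.from T-≡
           (trans (sym (lookup∘tabulate _ i)) ([]=⇒lookup i∈ap))))
    = j , ∈-upTo⁻ j∈upTo , ≡ᵇ⇒≡ _ _ hit

  ∈-apSet⁺ : (j : ℕ) → j < k → suc (toℕ i) ≡ a ℕ+ j * r → i ∈ apSet n a r k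
  ∈-apSet⁺ j j<k hit = lookup⇒[]= i _ (trans (lookup∘tabulate _ i)
    (Equivalence.to T-≡ (Any.any⁺ _ (lose (∈-upTo⁺ j<k) (≡⇒≡ᵇ _ _ hit)))))

apSet-term : ∀ a r k u → 1 ≤ a → (∀ j → j < k → a ℕ+ j * r ≤ n) → u < k →
  Σ (Fin n) λ e → e ∈ apSet n a r k × suc (toℕ e) ≡ a ℕ+ u * r
apSet-term a r k u 1≤a bounded u<k =
  e , ∈-apSet⁺ a r k u u<k (toℕ-fromValue _ 1≤v v≤n) , toℕ-fromValue _ 1≤v v≤n
  where
  1≤v = ≤-trans 1≤a (m≤m+n a (u * r))
  v≤n = bounded u u<k
  e = fromValue (a ℕ+ u * r) 1≤v v≤n

∉-apSet-0 : (a r : ℕ) {i : Fin n} → i ∉ apSet n a r 0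
∉-apSet-0 a r i∈ap with _ , () , _ ← ∈-apSet⁻ a r 0 i∈ap

fits : (n a r k : ℕ) → Bool
fits n a r k = (k ≡ᵇ 0) ∨ (a ℕ+ (k ∸ 1) * r ≤ᵇ n)

progressions : (n a r : ℕ) → List (Subset n)
progressions n a r = map (apSet n a r) (filterᵇ (fits n a r) (upTo (suc n)))

Lₙ-unique : (n : ℕ) → Unique (Lₙ n)
Lₙ-unique n = Unique.deduplicate-! _≟ₛ_ _

apSet∈Lₙ : {a r k : ℕ} → 1 ≤ a → a ≤ n → 1 ≤ r → r ≤ n → k ≤ n → T (fits n a r k) → apSet n a r k ∈ₗ Lₙ n
apSet∈Lₙ {n} {a} {r} {k} 1≤a a≤n 1≤r r≤n k≤n fit =
  ∈-deduplicate⁺ _≟ₛ_ (∈-concatMap⁺ _ (lose (∈-positive a 1≤a a≤n) (∈-concatMap⁺ _ (lose (∈-positive r 1≤r r≤n)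
    (∈-map⁺ (apSet n a r) (∈-filter⁺ (T? ∘ fits n a r) (∈-upTo⁺ (s≤s k≤n)) fit))))))
  where
  ∈-positive : ∀ v → 1 ≤ v → v ≤ n → v ∈ₗ map suc (upTo n)
  ∈-positive (suc v) _ v≤n = ∈-map⁺ suc (∈-upTo⁺ v≤n)

InL⇒∈Lₙ : 1 ≤ n → {x : Subset n} → InL n x → x ∈ₗ Lₙ n
InL⇒∈Lₙ 1≤n (_ , _ , zero , _ , _ , _ , refl) = apSet∈Lₙ ≤-refl 1≤n ≤-refl 1≤n z≤n _
InL⇒∈Lₙ {n} 1≤n (a , r , suc zero , 1≤a , _ , bounded , refl) =
  apSet∈Lₙ 1≤a a≤n ≤-refl 1≤n (≤-trans 1≤a a≤n) (≤⇒≤ᵇ (≤-trans (≤-reflexive (+-identityʳ a)) a≤n))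
  where a≤n = ≤-trans (≤-reflexive (sym (+-identityʳ a))) (bounded 0 (s≤s z≤n))
InL⇒∈Lₙ {n} 1≤n (a , r , suc (suc k) , 1≤a , 1≤r , bounded , refl) =
  apSet∈Lₙ 1≤a a≤n 1≤r r≤n k+2≤n (≤⇒≤ᵇ (bounded (suc k) ≤-refl))
  where
  a≤n = ≤-trans (≤-reflexive (sym (+-identityʳ a))) (bounded 0 (s≤s z≤n))
  r≤n : r ≤ n
  r≤n = ≤-trans (m≤n+m r a) (≤-trans (≤-reflexive (cong (a ℕ+_) (sym (*-identityˡ r)))) (bounded 1 (s≤s (s≤s z≤n))))
  k+2≤n : suc (suc k) ≤ n
  k+2≤n = ≤-trans (+-mono-≤ 1≤a (≤-trans (≤-reflexive (sym (*-identityʳ (suc k)))) (*-monoʳ-≤ (suc k) 1≤r)))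
                  (bounded (suc k) ≤-refl)

∈Lₙ⇒InL : {x : Subset n} → x ∈ₗ Lₙ n → InL n x
∈Lₙ⇒InL {n} x∈Lₙ
  with a , a∈ , x∈a ← find (∈-concatMap⁻ (λ a → concatMap (progressions n a) (map suc (upTo n))) {xs = map suc (upTo n)}
                                         (∈-deduplicate⁻ _≟ₛ_ _ x∈Lₙ))
  with r , r∈ , x∈ar ← find (∈-concatMap⁻ (progressions n a) {xs = map suc (upTo n)} x∈a)
  with k , k∈ , refl ← ∈-map⁻ (apSet n a r) {xs = filterᵇ (fits n a r) (upTo (suc n))} x∈ar
  with a₀ , _ , refl ← ∈-map⁻ suc a∈
  with r₀ , _ , refl ← ∈-map⁻ suc r∈
  = suc a₀ , suc r₀ , k , s≤s z≤n , s≤s z≤n ,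
    bounded k (proj₂ (∈-filter⁻ (T? ∘ fits n _ _) {xs = upTo (suc n)} k∈)) , refl
  where
  bounded : ∀ k → T (fits n (suc a₀) (suc r₀) k) → ∀ j → j < k → suc a₀ ℕ+ j * suc r₀ ≤ n
  bounded (suc k) fit j (s≤s j≤k) = ≤-trans (+-monoʳ-≤ (suc a₀) (*-monoˡ-≤ (suc r₀) j≤k)) (≤ᵇ⇒≤ _ _ fit)

-- Intersections of arithmetic progressions

empty-or-least : (p : Subset n) →
  (∀ i → i ∉ p) ⊎ Σ (Fin n) λ i₀ → i₀ ∈ p × (∀ {i} → i ∈ p → toℕ i₀ ≤ toℕ i)
empty-or-least {n} p with all? (λ i → ¬? (i ∈? p))
... | yes empty = inj₁ empty
... | no ¬empty
  with i₀ , i₀∈p , below-∉ ← ¬∀⟶∃¬-smallest n (_∉ p) (λ i → ¬? (i ∈? p)) ¬empty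
  = inj₂ (i₀ , decidable-stable (i₀ ∈? p) i₀∈p , least)
  where
  least : ∀ {i} → i ∈ p → toℕ i₀ ≤ toℕ i
  least {i} i∈p = ≮⇒≥ λ i<i₀ → below-∉ (fromℕ< i<i₀)
    (subst (_∈ p) (toℕ-injective (sym (trans (toℕ-inject (fromℕ< i<i₀)) (toℕ-fromℕ< i<i₀)))) i∈p)

index-≤ : ∀ a {j k r} → 1 ≤ r → a ℕ+ j * r ≤ a ℕ+ k * r → j ≤ k
index-≤ a {j} {k} {suc r} _ le = *-cancelʳ-≤ j k (suc r) (+-cancelˡ-≤ a _ _ le)

index-injective : ∀ a {j k r} → 1 ≤ r → a ℕ+ j * r ≡ a ℕ+ k * r → j ≡ k
index-injective a {j} {k} {suc r} _ e = *-cancelʳ-≡ j k (suc r) (+-cancelˡ-≡ a _ _ e)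

+-*-distribʳ : ∀ a i d r → a ℕ+ (i ℕ+ d) * r ≡ (a ℕ+ i * r) ℕ+ d * r
+-*-distribʳ a i d r = trans (cong (a ℕ+_) (*-distribʳ-+ r i d)) (sym (+-assoc a _ _))

apLast : ℕ → ℕ → ℕ → ℕ
apLast a r k = a ℕ+ (k ∸ 1) * r

≤-apLast : ∀ a r {j k} → j < k → a ℕ+ j * r ≤ apLast a r k
≤-apLast a r {j} {suc k} (s≤s j≤k) = +-monoʳ-≤ a (*-monoˡ-≤ r j≤k)

apLast-bounded : ∀ {a r i k} → i < k → (∀ j → j < k → a ℕ+ j * r ≤ n) → apLast a r k ≤ n
apLast-bounded {k = suc k} _ bounded = bounded k ≤-refl

progression-gap : ∀ a {r i j t v} → 1 ≤ r → t ≡ a ℕ+ i * r → v ≡ a ℕ+ j * r → t ≤ v →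
  v ≡ t ℕ+ (j ∸ i) * r
progression-gap a {r} {i} {j} 1≤r refl refl t≤v = begin
  a ℕ+ j * r               ≡⟨ cong (λ x → a ℕ+ x * r) (sym (m+[n∸m]≡n (index-≤ a {i} {j} 1≤r t≤v))) ⟩
  a ℕ+ (i ℕ+ (j ∸ i)) * r  ≡⟨ +-*-distribʳ a i (j ∸ i) r ⟩
  a ℕ+ i * r ℕ+ (j ∸ i) * r ∎
  where open ≡-Reasoning

∈-apSet-step : ∀ a r k {i d} {e : Fin n} → 1 ≤ r → i < k → suc (toℕ e) ≡ (a ℕ+ i * r) ℕ+ d * r →
  suc (toℕ e) ≤ apLast a r k → e ∈ apSet n a r k
∈-apSet-step a r (suc k) {i} {d} 1≤r _ e≡ e≤last = ∈-apSet⁺ a r (suc k) (i ℕ+ d) (s≤s i+d≤k) e≡′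
  where
  e≡′ = trans e≡ (sym (+-*-distribʳ a i d r))
  i+d≤k = index-≤ a 1≤r (subst (_≤ apLast a r (suc k)) e≡′ e≤last)

lcm-nonZero : ∀ {r s} → 1 ≤ r → 1 ≤ s → NonZero (lcm r s)
lcm-nonZero {suc r} {suc s} _ _ = ≢-nonZero λ l≡0 → case
  trans (sym (gcd*lcm (suc r) (suc s))) (trans (cong (g *_) l≡0) (*-zeroʳ g)) of λ ()
  where g = gcd (suc r) (suc s)

m*n≤o⇒m≤o/n : ∀ m {n o} .{{_ : NonZero n}} → m * n ≤ o → m ≤ o / n
m*n≤o⇒m≤o/n m {n} m*n≤o = subst (_≤ _ / n) (m*n/n≡m m n) (/-monoˡ-≤ n m*n≤o)

module ∩-Progression {a r k b s m : ℕ} (1≤r : 1 ≤ r) (1≤s : 1 ≤ s)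
  (x-bounded : ∀ j → j < k → a ℕ+ j * r ≤ n)
  (i₀ : Fin n) (i₀∈ : i₀ ∈ apSet n a r k ∩ apSet n b s m)
  (i₀-least : ∀ {i} → i ∈ apSet n a r k ∩ apSet n b s m → toℕ i₀ ≤ toℕ i)
  (i₁ : ℕ) (i₁<k : i₁ < k) (t₀≡x : suc (toℕ i₀) ≡ a ℕ+ i₁ * r)
  (j₁ : ℕ) (j₁<m : j₁ < m) (t₀≡z : suc (toℕ i₀) ≡ b ℕ+ j₁ * s) where

  t₀ top l : ℕ
  t₀ = suc (toℕ i₀)
  top = apLast a r k ⊓ apLast b s m
  l = lcm r s

  instance
    l≢0 : NonZero l
    l≢0 = lcm-nonZero 1≤r 1≤s

  K : ℕ
  K = suc ((top ∸ t₀) / l)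

  ∈∩⇒≤top : {e : Fin n} → e ∈ apSet n a r k ∩ apSet n b s m → suc (toℕ e) ≤ top
  ∈∩⇒≤top e∈
    with _ , j<k , e≡x ← ∈-apSet⁻ a r k (proj₁ (x∈p∩q⁻ _ _ e∈))
    with _ , j<m , e≡z ← ∈-apSet⁻ b s m (proj₂ (x∈p∩q⁻ _ _ e∈))
    = ⊓-glb (subst (_≤ apLast a r k) (sym e≡x) (≤-apLast a r j<k))
            (subst (_≤ apLast b s m) (sym e≡z) (≤-apLast b s j<m))

  t₀≤top : t₀ ≤ top
  t₀≤top = ∈∩⇒≤top i₀∈

  ∩⊆progression : apSet n a r k ∩ apSet n b s m ⊆ apSet n t₀ l K
  ∩⊆progression {e} e∈
    with i₂ , _ , e≡x ← ∈-apSet⁻ a r k (proj₁ (x∈p∩q⁻ _ _ e∈))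
    with j₂ , _ , e≡z ← ∈-apSet⁻ b s m (proj₂ (x∈p∩q⁻ _ _ e∈))
    = ∈-apSet⁺ t₀ l K q (s≤s (m*n≤o⇒m≤o/n q (m+n≤o⇒m≤o∸n (q * l) ql+t₀≤top))) e≡t₀+ql
    where
    t₀≤e = s≤s (i₀-least e∈)
    gap-x = progression-gap a {i = i₁} {i₂} 1≤r t₀≡x e≡x t₀≤e
    gap-z = progression-gap b {i = j₁} {j₂} 1≤s t₀≡z e≡z t₀≤e
    l∣gap : l ∣ (i₂ ∸ i₁) * r
    l∣gap = lcm-least (divides (i₂ ∸ i₁) refl) (divides (j₂ ∸ j₁) (+-cancelˡ-≡ t₀ _ _ (trans (sym gap-x) gap-z)))
    q = quotient l∣gap
    e≡t₀+ql : suc (toℕ e) ≡ t₀ ℕ+ q * l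
    e≡t₀+ql = trans gap-x (cong (t₀ ℕ+_) (_∣_.equality l∣gap))
    ql+t₀≤top : q * l ℕ+ t₀ ≤ top
    ql+t₀≤top = subst (_≤ top) (trans e≡t₀+ql (+-comm t₀ (q * l))) (∈∩⇒≤top e∈)

  private
    t₀+ql≤top : ∀ q → q < K → t₀ ℕ+ q * l ≤ top
    t₀+ql≤top q (s≤s q≤) = begin
      t₀ ℕ+ q * l                   ≤⟨ +-monoʳ-≤ t₀ (≤-trans (*-monoˡ-≤ l q≤) (m/n*n≤m (top ∸ t₀) l)) ⟩
      t₀ ℕ+ (top ∸ t₀)              ≡⟨ m+[n∸m]≡n t₀≤top ⟩
      top                           ∎
      where open ≤-Reasoning

    ∈-factor : ∀ a′ r′ k′ i′ {e : Fin n} {q} → 1 ≤ r′ → i′ < k′ → t₀ ≡ a′ ℕ+ i′ * r′ → r′ ∣ l →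
      top ≤ apLast a′ r′ k′ → suc (toℕ e) ≡ t₀ ℕ+ q * l → q < K → e ∈ apSet n a′ r′ k′
    ∈-factor a′ r′ k′ i′ {q = q} 1≤r′ i′<k′ t₀≡ (divides c l≡cr′) top≤ e≡ q<K =
      ∈-apSet-step a′ r′ k′ {d = q * c} 1≤r′ i′<k′ e≡′ (≤-trans (≤-trans (≤-reflexive e≡) (t₀+ql≤top q q<K)) top≤)
      where
      e≡′ = trans e≡ (trans (cong₂ (λ t u → t ℕ+ q * u) t₀≡ l≡cr′) (cong (a′ ℕ+ i′ * r′ ℕ+_) (sym (*-assoc q c r′))))

  progression⊆∩ : apSet n t₀ l K ⊆ apSet n a r k ∩ apSet n b s m
  progression⊆∩ e∈ with q , q<K , e≡ ← ∈-apSet⁻ t₀ l K e∈ =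
    x∈p∩q⁺ ( ∈-factor a r k i₁ 1≤r i₁<k t₀≡x (m∣lcm[m,n] r s) (m⊓n≤m _ _) e≡ q<K
           , ∈-factor b s m j₁ 1≤s j₁<m t₀≡z (n∣lcm[m,n] r s) (m⊓n≤n _ _) e≡ q<K)

  progression-bounded : ∀ q → q < K → t₀ ℕ+ q * l ≤ n
  progression-bounded q q<K = ≤-trans (t₀+ql≤top q q<K) (≤-trans (m⊓n≤m _ _) (apLast-bounded i₁<k x-bounded))

InL-∩ : {x z : Subset n} → InL n x → InL n z → InL n (x ∩ z)
InL-∩ {n} (a , r , k , _ , 1≤r , x-bounded , refl) (b , s , m , _ , 1≤s , _ , refl)
  with empty-or-least (apSet n a r k ∩ apSet n b s m)
... | inj₁ empty =
  1 , 1 , 0 , ≤-refl , ≤-refl , (λ _ ()) ,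
  ⊆-antisym (λ e∈ → ⊥-elim (empty _ e∈)) (λ e∈ → ⊥-elim (∉-apSet-0 1 1 e∈))
... | inj₂ (i₀ , i₀∈ , least)
  with i₁ , i₁<k , t₀≡x ← ∈-apSet⁻ a r k (proj₁ (x∈p∩q⁻ _ _ i₀∈))
  with j₁ , j₁<m , t₀≡z ← ∈-apSet⁻ b s m (proj₂ (x∈p∩q⁻ _ _ i₀∈))
  = t₀ , l , K , s≤s z≤n , >-nonZero⁻¹ l , progression-bounded , ⊆-antisym ∩⊆progression progression⊆∩
  where open ∩-Progression 1≤r 1≤s x-bounded i₀ i₀∈ least i₁ i₁<k t₀≡x j₁ j₁<m t₀≡z

∩-∈Lₙ : 1 ≤ n → {x z : Subset n} → x ∈ₗ Lₙ n → z ∈ₗ Lₙ n → x ∩ z ∈ₗ Lₙ n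
∩-∈Lₙ 1≤n x∈L z∈L = InL⇒∈Lₙ 1≤n (InL-∩ (∈Lₙ⇒InL x∈L) (∈Lₙ⇒InL z∈L))

meetFrom-∈Lₙ : 1 ≤ n → {y : Subset n} → y ∈ₗ Lₙ n → (S : List (Subset n)) →
  (∀ {c} → c ∈ₗ S → c ∈ₗ Lₙ n) → meetFrom y S ∈ₗ Lₙ n
meetFrom-∈Lₙ 1≤n y∈L []      S⊆L = y∈L
meetFrom-∈Lₙ 1≤n y∈L (c ∷ S) S⊆L = ∩-∈Lₙ 1≤n (S⊆L (here refl)) (meetFrom-∈Lₙ 1≤n y∈L S (S⊆L ∘ there))

-- The Möbius function of Lₙ

-- Literally the filter of μ-fuel, so that μ unfolds definitionally.
halfOpen : Subset n → Subset n → Subset n → Bool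
halfOpen x y z =
  if does (x ⊆? z) then (if does (z ⊆? y) then (if does (z ≟ₛ y) then false else true) else false) else false

halfOpen⁻ : (x y z : Subset n) → halfOpen x y z ≡ true → x ⊆ z × z ⊆ y × z ≢ y
halfOpen⁻ x y z h with x ⊆? z | z ⊆? y | z ≟ₛ y
... | yes x⊆z | yes z⊆y | no z≢y = x⊆z , z⊆y , z≢y
halfOpen⁻ x y z () | yes _ | yes _ | yes _
halfOpen⁻ x y z () | yes _ | no _  | _
halfOpen⁻ x y z () | no _  | _     | _

∑-halfOpen-≡0 : (x y : Subset n) (l : List (Subset n)) (g : Subset n → ℤ) →
  (∀ {z} → x ⊆ z → z ⊆ y → z ≢ y → ⊥) → ∑ (filterᵇ (halfOpen x y) l) g ≡ + 0
∑-halfOpen-≡0 x y l g empty = trans (∑-filter l (halfOpen x y) g) (∑-zero l vanish)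
  where
  vanish : ∀ {z} → z ∈ₗ l → (if halfOpen x y z then g z else + 0) ≡ + 0
  vanish {z} _ with halfOpen x y z in h
  ... | true  = let x⊆z , z⊆y , z≢y = halfOpen⁻ x y z h in ⊥-elim (empty x⊆z z⊆y z≢y)
  ... | false = refl

-- The recursion of μ-fuel only descends along strictly increasing chains, so fuel
-- ∣ z ∣ ∸ ∣ x ∣ is already enough.
μ-fuel-stable : (f : ℕ) (x z : Subset n) → (x ⊆ z → ∣ z ∣ ∸ ∣ x ∣ ≤ f) →
  μ-fuel n f x z ≡ μ-fuel n (suc f) x z
μ-fuel-stable f x z enough with x ≟ₛ z
... | yes _ = refl
μ-fuel-stable {n} zero x z enough | no x≢z with x ⊆? z
... | yes x⊆z = ⊥-elim (<⇒≱ (∸-monoˡ-< (⊆∧≢⇒∣∣< x⊆z x≢z) ≤-refl)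
                              (≤-trans (enough x⊆z) (≤-reflexive (sym (n∸n≡0 ∣ x ∣)))))
... | no x⊈z = sym (cong -_ (∑-halfOpen-≡0 x z (Lₙ n) _ λ x⊆w w⊆z _ → x⊈z (⊆-trans x⊆w w⊆z)))
μ-fuel-stable {n} (suc f) x z enough | no _ =
  cong -_ (∑-cong (filterᵇ (halfOpen x z) (Lₙ n)) λ {w} w∈ → μ-fuel-stable f x w (enough′ w w∈))
  where
  enough′ : ∀ w → w ∈ₗ filterᵇ (halfOpen x z) (Lₙ n) → x ⊆ w → ∣ w ∣ ∸ ∣ x ∣ ≤ f
  enough′ w w∈ x⊆w
    with _ , w⊆z , w≢z ← halfOpen⁻ x z w (Equivalence.to T-≡ (proj₂ (∈-filter⁻ (T? ∘ halfOpen x z) {xs = Lₙ n} w∈)))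
    = ≤-pred (≤-trans (∸-monoˡ-< (⊆∧≢⇒∣∣< w⊆z w≢z) (p⊆q⇒∣p∣≤∣q∣ x⊆w)) (enough (⊆-trans x⊆w w⊆z)))

μ-refl : (x : Subset n) → μ n x x ≡ + 1
μ-refl x with x ≟ₛ x
... | yes _   = refl
... | no x≢x = ⊥-elim (x≢x refl)

μ-unfold : (x y : Subset n) → x ≢ y → μ n x y ≡ - ∑ (filterᵇ (halfOpen x y) (Lₙ n)) (μ n x)
μ-unfold {n} x y x≢y with x ≟ₛ y
... | yes x≡y = ⊥-elim (x≢y x≡y)
... | no _ = cong -_ (∑-cong (filterᵇ (halfOpen x y) (Lₙ n)) λ {w} _ →
               μ-fuel-stable n x w λ _ → ≤-trans (m∸n≤m ∣ w ∣ ∣ x ∣) (∣p∣≤n w))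

∑-halfOpen-μ : (x y : Subset n) → x ≢ y → ∑ (filterᵇ (halfOpen x y) (Lₙ n)) (μ n x) ≡ - μ n x y
∑-halfOpen-μ x y x≢y = trans (sym (ℤ.neg-involutive _)) (cong -_ (sym (μ-unfold x y x≢y)))

δ : Subset n → Subset n → ℤ
δ x y = if does (x ≟ₛ y) then + 1 else + 0

private
  split-top : (x y z : Subset n) (v : ℤ) →
    (if does (between? x y z) then v else + 0) ≡
    (if halfOpen x y z then v else + 0) + (if does (z ≟ₛ y) then (if does (x ⊆? z) then v else + 0) else + 0)
  split-top x y z v with x ⊆? z | z ⊆? y | z ≟ₛ y
  ... | yes _ | yes _   | yes _    = sym (ℤ.+-identityˡ _)
  ... | yes _ | yes _   | no _     = sym (ℤ.+-identityʳ _)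
  ... | yes _ | no z⊈y  | yes refl = ⊥-elim (z⊈y ⊆-refl)
  ... | yes _ | no _    | no _     = refl
  ... | no _  | _       | yes _    = refl
  ... | no _  | _       | no _     = refl

∑-μ-interval : (x y : Subset n) → y ∈ₗ Lₙ n →
  ∑[ z ∈ Lₙ n ] (if does (between? x y z) then μ n x z else + 0) ≡ δ x y
∑-μ-interval {n} x y y∈L = begin
  ∑[ z ∈ L ] (if does (between? x y z) then μ n x z else + 0)
    ≡⟨ ∑-cong L (λ {z} _ → split-top x y z (μ n x z)) ⟩
  ∑[ z ∈ L ] ((if halfOpen x y z then μ n x z else + 0) + top z)
    ≡⟨ ∑-distrib-+ L _ top ⟩
  (∑[ z ∈ L ] (if halfOpen x y z then μ n x z else + 0)) + ∑ L top
    ≡⟨ cong₂ _+_ (sym (∑-filter L (halfOpen x y) (μ n x))) (∑-indicator _≟ₛ_ L y _ (Lₙ-unique n) y∈L) ⟩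
  ∑ (filterᵇ (halfOpen x y) L) (μ n x) + (if does (x ⊆? y) then μ n x y else + 0)
    ≡⟨ below+top≡δ (x ≟ₛ y) ⟩
  δ x y ∎
  where
  open ≡-Reasoning
  L = Lₙ n
  top : Subset n → ℤ
  top z = if does (z ≟ₛ y) then (if does (x ⊆? z) then μ n x z else + 0) else + 0
  below+top≡δ : Dec (x ≡ y) → ∑ (filterᵇ (halfOpen x y) L) (μ n x) + (if does (x ⊆? y) then μ n x y else + 0) ≡ δ x y
  below+top≡δ (yes refl) = begin
    ∑ (filterᵇ (halfOpen x x) L) (μ n x) + (if does (x ⊆? x) then μ n x x else + 0)
      ≡⟨ cong₂ _+_ (∑-halfOpen-≡0 x x L (μ n x) λ x⊆z z⊆x z≢x → z≢x (⊆-antisym z⊆x x⊆z))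
                   (trans (if-yes (x ⊆? x) ⊆-refl) (μ-refl x)) ⟩
    + 1
      ≡⟨ sym (if-yes (x ≟ₛ x) refl) ⟩
    δ x x ∎
  below+top≡δ (no x≢y) = trans (∑-below+top (x ⊆? y)) (sym (if-no (x ≟ₛ y) x≢y))
    where
    ∑-below+top : Dec (x ⊆ y) → ∑ (filterᵇ (halfOpen x y) L) (μ n x) + (if does (x ⊆? y) then μ n x y else + 0) ≡ + 0
    ∑-below+top (yes x⊆y) =
      trans (cong₂ _+_ (∑-halfOpen-μ x y x≢y) (if-yes (x ⊆? y) x⊆y)) (ℤ.+-inverseˡ (μ n x y))
    ∑-below+top (no x⊈y) =
      cong₂ _+_ (∑-halfOpen-≡0 x y L (μ n x) λ x⊆z z⊆y _ → x⊈y (⊆-trans x⊆z z⊆y)) (if-no (x ⊆? y) x⊈y)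

∑-*-δ : (l : List (Subset n)) (f : Subset n → ℤ) {y : Subset n} → Unique l → y ∈ₗ l →
  ∑[ z ∈ l ] (f z ℤ.* δ z y) ≡ f y
∑-*-δ l f {y} l! y∈l = trans (∑-cong l λ {z} _ → *-δ z) (∑-indicator _≟ₛ_ l y f l! y∈l)
  where
  *-δ : ∀ z → f z ℤ.* δ z y ≡ (if does (z ≟ₛ y) then f z else + 0)
  *-δ z with z ≟ₛ y
  ... | yes _ = ℤ.*-identityʳ (f z)
  ... | no _  = ℤ.*-zeroʳ (f z)

δ-sym : (x y : Subset n) → δ x y ≡ δ y x
δ-sym x y with x ≟ₛ y | y ≟ₛ x
... | yes _   | yes _   = refl
... | no _    | no _    = refl
... | yes x≡y | no y≢x  = ⊥-elim (y≢x (sym x≡y))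
... | no x≢y  | yes y≡x = ⊥-elim (x≢y (sym y≡x))

-- Associativity in the incidence algebra: μ = μ ∗ (ζ ∗ ν) = (μ ∗ ζ) ∗ ν = ν.
μ-unique : (ν : Subset n → Subset n → ℤ) {y : Subset n} → y ∈ₗ Lₙ n →
  (∀ {z} → z ∈ₗ Lₙ n → z ⊆ y → ∑[ w ∈ Lₙ n ] (if does (between? z y w) then ν w y else + 0) ≡ δ z y) →
  {x : Subset n} → x ∈ₗ Lₙ n → x ⊆ y → μ n x y ≡ ν x y
μ-unique {n} ν {y} y∈L ζ∗ν≡δ {x} x∈L x⊆y = begin
  μ n x y
    ≡⟨ sym (trans (∑-*-δ L (μ-upto y) (Lₙ-unique n) y∈L) (if-yes (between? x y y) (x⊆y , ⊆-refl))) ⟩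
  ∑[ z ∈ L ] (μ-upto y z ℤ.* δ z y)
    ≡⟨ ∑-cong L (λ z∈L → expand-δ z∈L) ⟩
  ∑[ z ∈ L ] (μ-upto y z ℤ.* (∑[ w ∈ L ] ν-from z w))
    ≡⟨ ∑-cong L (λ {z} _ → sym (*-distribˡ-∑ (μ-upto y z) L (ν-from z))) ⟩
  ∑[ z ∈ L ] ∑[ w ∈ L ] (μ-upto y z ℤ.* ν-from z w)
    ≡⟨ ∑-cong L (λ {z} _ → ∑-cong L λ {w} _ → chain-from-x z w) ⟩
  ∑[ z ∈ L ] ∑[ w ∈ L ] chain z w
    ≡⟨ ∑-comm L L chain ⟩
  ∑[ w ∈ L ] ∑[ z ∈ L ] chain z w
    ≡⟨ ∑-cong L (λ {w} _ → ∑-cong L λ {z} _ → sym (chain-to-y z w)) ⟩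
  ∑[ w ∈ L ] ∑[ z ∈ L ] (ν-from x w ℤ.* μ-upto w z)
    ≡⟨ ∑-cong L (λ {w} _ → *-distribˡ-∑ (ν-from x w) L (μ-upto w)) ⟩
  ∑[ w ∈ L ] (ν-from x w ℤ.* (∑[ z ∈ L ] μ-upto w z))
    ≡⟨ ∑-cong L (λ {w} w∈L → cong (ν-from x w ℤ.*_) (trans (∑-μ-interval x w w∈L) (δ-sym x w))) ⟩
  ∑[ w ∈ L ] (ν-from x w ℤ.* δ w x)
    ≡⟨ trans (∑-*-δ L (ν-from x) (Lₙ-unique n) x∈L) (if-yes (between? x y x) (⊆-refl , x⊆y)) ⟩
  ν x y ∎
  where
  open ≡-Reasoning
  L = Lₙ n
  μ-upto : Subset n → Subset n → ℤ
  μ-upto w z = if does (between? x w z) then μ n x z else + 0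
  ν-from : Subset n → Subset n → ℤ
  ν-from z w = if does (between? z y w) then ν w y else + 0
  chain? : (z w : Subset n) → Dec (x ⊆ z × z ⊆ w × w ⊆ y)
  chain? z w = x ⊆? z ×-dec (z ⊆? w ×-dec w ⊆? y)
  chain : Subset n → Subset n → ℤ
  chain z w = if does (chain? z w) then μ n x z ℤ.* ν w y else + 0
  chain-from-x : ∀ z w → μ-upto y z ℤ.* ν-from z w ≡ chain z w
  chain-from-x z w = indicator-* (between? x y z) (between? z y w) (chain? z w)
    (λ ((x⊆z , _) , (z⊆w , w⊆y)) → x⊆z , z⊆w , w⊆y)
    (λ (x⊆z , z⊆w , w⊆y) → (x⊆z , ⊆-trans z⊆w w⊆y) , (z⊆w , w⊆y)) (μ n x z) (ν w y)
  chain-to-y : ∀ z w → ν-from x w ℤ.* μ-upto w z ≡ chain z w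
  chain-to-y z w = trans (indicator-* (between? x y w) (between? x w z) (chain? z w)
    (λ ((_ , w⊆y) , (x⊆z , z⊆w)) → x⊆z , z⊆w , w⊆y)
    (λ (x⊆z , z⊆w , w⊆y) → (⊆-trans x⊆z z⊆w , w⊆y) , (x⊆z , z⊆w)) (ν w y) (μ n x z))
    (cong (λ t → if does (chain? z w) then t else + 0) (ℤ.*-comm (ν w y) (μ n x z)))
  expand-δ : ∀ {z} → z ∈ₗ L → μ-upto y z ℤ.* δ z y ≡ μ-upto y z ℤ.* (∑[ w ∈ L ] ν-from z w)
  expand-δ {z} z∈L = by-cases (z ⊆? y)
    where
    by-cases : Dec (z ⊆ y) → μ-upto y z ℤ.* δ z y ≡ μ-upto y z ℤ.* (∑[ w ∈ L ] ν-from z w)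
    by-cases (yes z⊆y) = cong (μ-upto y z ℤ.*_) (sym (ζ∗ν≡δ z∈L z⊆y))
    by-cases (no z⊈y)  = trans (cong (ℤ._* δ z y) vanish) (sym (cong (ℤ._* (∑[ w ∈ L ] ν-from z w)) vanish))
      where vanish = if-no (between? x y z) (z⊈y ∘ proj₂)

sublists : List A → List (List A)
sublists []      = [] ∷ []
sublists (c ∷ l) = map (c ∷_) (sublists l) ++ sublists l

∑-sublists-∷ : (c : A) (l : List A) (f : List A → ℤ) →
  ∑ (sublists (c ∷ l)) f ≡ (∑[ S ∈ sublists l ] f (c ∷ S)) + ∑ (sublists l) f
∑-sublists-∷ c l f =
  trans (∑-++ (map (c ∷_) (sublists l)) (sublists l) f) (cong (_+ ∑ (sublists l) f) (∑-map (sublists l) (c ∷_) f))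

∈-sublists⇒⊆ : (l : List A) {S : List A} → S ∈ₗ sublists l → ∀ {c} → c ∈ₗ S → c ∈ₗ l
∈-sublists⇒⊆ []      (here refl) ()
∈-sublists⇒⊆ (d ∷ l) S∈ c∈S with ∈-++⁻ (map (d ∷_) (sublists l)) S∈
... | inj₂ S∈l = there (∈-sublists⇒⊆ l S∈l c∈S)
... | inj₁ S∈dl with S′ , S′∈ , refl ← ∈-map⁻ (d ∷_) S∈dl with c∈S
...   | here c≡d   = here c≡d
...   | there c∈S′ = there (∈-sublists⇒⊆ l S′∈ c∈S′)

sign-suc : (k : ℕ) → sign (suc k) ≡ - sign k
sign-suc k = ℤ.-1*i≡-i (sign k)

signIfAll : (A → Bool) → List A → ℤ
signIfAll p S = if all p S then sign (length S) else + 0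

∑-sublists-alternating : (p : A → Bool) (l : List A) →
  ∑ (sublists l) (signIfAll p) ≡ (if any p l then + 0 else + 1)
∑-sublists-alternating p []      = refl
∑-sublists-alternating p (c ∷ l) with p c in pc
... | true = begin
  ∑ (sublists (c ∷ l)) (signIfAll p)                                         ≡⟨ ∑-sublists-∷ c l (signIfAll p) ⟩
  (∑[ S ∈ sublists l ] signIfAll p (c ∷ S)) + ∑ (sublists l) (signIfAll p)
    ≡⟨ cong (_+ ∑ (sublists l) (signIfAll p))
            (trans (∑-cong (sublists l) λ {S} _ → negate S) (neg-distrib-∑ (sublists l) _)) ⟩
  - ∑ (sublists l) (signIfAll p) + ∑ (sublists l) (signIfAll p)
    ≡⟨ ℤ.+-inverseˡ (∑ (sublists l) (signIfAll p)) ⟩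
  + 0 ∎
  where
  open ≡-Reasoning
  negate : ∀ S → signIfAll p (c ∷ S) ≡ - signIfAll p S
  negate S rewrite pc with all p S
  ... | true  = sign-suc (length S)
  ... | false = refl
... | false = begin
  ∑ (sublists (c ∷ l)) (signIfAll p)                                         ≡⟨ ∑-sublists-∷ c l (signIfAll p) ⟩
  (∑[ S ∈ sublists l ] signIfAll p (c ∷ S)) + ∑ (sublists l) (signIfAll p)
    ≡⟨ cong (_+ ∑ (sublists l) (signIfAll p)) (∑-zero (sublists l) λ {S} _ → vanish S) ⟩
  + 0 + ∑ (sublists l) (signIfAll p)                                         ≡⟨ ℤ.+-identityˡ _ ⟩
  ∑ (sublists l) (signIfAll p)                                               ≡⟨ ∑-sublists-alternating p l ⟩
  (if any p l then + 0 else + 1) ∎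
  where
  open ≡-Reasoning
  vanish : ∀ S → signIfAll p (c ∷ S) ≡ + 0
  vanish S rewrite pc = refl

-- Coatoms and the crosscut sum

-- CoveredBy with the intermediate elements drawn from the list Lₙ n, which makes it decidable.
IsCoatom : Subset n → Subset n → Set
IsCoatom {n} y c = c ⊆ y × c ≢ y × All (λ z → c ⊆ z → z ⊆ y → (z ≡ c) ⊎ (z ≡ y)) (Lₙ n)

isCoatom? : (y c : Subset n) → Dec (IsCoatom y c)
isCoatom? {n} y c = c ⊆? y ×-dec ¬? (c ≟ₛ y) ×-dec All.all? interval-trivial? (Lₙ n)
  where
  interval-trivial? : ∀ z → Dec (c ⊆ z → z ⊆ y → (z ≡ c) ⊎ (z ≡ y))
  interval-trivial? z with z ≟ₛ c | z ≟ₛ y | c ⊆? z | z ⊆? y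
  ... | yes z≡c | _       | _       | _       = yes λ _ _ → inj₁ z≡c
  ... | no _    | yes z≡y | _       | _       = yes λ _ _ → inj₂ z≡y
  ... | no _    | no _    | no c⊈z  | _       = yes λ c⊆z _ → ⊥-elim (c⊈z c⊆z)
  ... | no _    | no _    | yes _   | no z⊈y  = yes λ _ z⊆y → ⊥-elim (z⊈y z⊆y)
  ... | no z≢c  | no z≢y  | yes c⊆z | yes z⊆y = no λ trivial → [ z≢c , z≢y ]′ (trivial c⊆z z⊆y)

coatoms : Subset n → List (Subset n)
coatoms {n} y = filter (isCoatom? y) (Lₙ n)

coatoms-unique : (y : Subset n) → Unique (coatoms y)
coatoms-unique {n} y = UniqueP.filter⁺ (isCoatom? y) (Lₙ-unique n)

∈-coatoms⁻ : (y : Subset n) {c : Subset n} → c ∈ₗ coatoms y → c ∈ₗ Lₙ n × IsCoatom y c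
∈-coatoms⁻ {n} y = ∈-filter⁻ (isCoatom? y) {xs = Lₙ n}

-- Maximising the cardinality over the elements of Lₙ strictly between z and y gives a coatom.
coatom-above : (y : Subset n) {z : Subset n} → z ∈ₗ Lₙ n → z ⊆ y → z ≢ y →
  Σ (Subset n) λ c → c ∈ₗ coatoms y × z ⊆ c
coatom-above {n} y {z} z∈L z⊆y z≢y = c , ∈-filter⁺ (isCoatom? y) c∈L (c⊆y , c≢y , All.tabulate maximal) , z⊆c
  where
  StrictlyBetween : Subset n → Set
  StrictlyBetween w = z ⊆ w × w ⊆ y × w ≢ y
  strictlyBetween? : ∀ w → Dec (StrictlyBetween w)
  strictlyBetween? w = z ⊆? w ×-dec w ⊆? y ×-dec ¬? (w ≟ₛ y)
  K = filter strictlyBetween? (Lₙ n)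
  c = argmax ∣_∣ z K
  c∈L×c-between : c ∈ₗ Lₙ n × StrictlyBetween c
  c∈L×c-between = argmax-all ∣_∣ {P = λ w → w ∈ₗ Lₙ n × StrictlyBetween w} (z∈L , ⊆-refl , z⊆y , z≢y)
                               (All.tabulate (∈-filter⁻ strictlyBetween? {xs = Lₙ n}))
  c∈L = proj₁ c∈L×c-between
  z⊆c = proj₁ (proj₂ c∈L×c-between)
  c⊆y = proj₁ (proj₂ (proj₂ c∈L×c-between))
  c≢y = proj₂ (proj₂ (proj₂ c∈L×c-between))
  maximal : ∀ {w} → w ∈ₗ Lₙ n → c ⊆ w → w ⊆ y → (w ≡ c) ⊎ (w ≡ y)
  maximal {w} w∈L c⊆w w⊆y with w ≟ₛ c | w ≟ₛ y
  ... | yes w≡c | _       = inj₁ w≡c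
  ... | no _    | yes w≡y = inj₂ w≡y
  ... | no w≢c  | no w≢y  = ⊥-elim (<⇒≱ (⊆∧≢⇒∣∣< c⊆w (w≢c ∘ sym))
          (All.lookup (f[xs]≤f[argmax] z K) (∈-filter⁺ strictlyBetween? w∈L (⊆-trans z⊆c c⊆w , w⊆y , w≢y))))

any-coatom-above : {y z : Subset n} → z ∈ₗ Lₙ n → z ⊆ y →
  (if any (λ c → isYes (z ⊆? c)) (coatoms y) then + 0 else + 1) ≡ δ z y
any-coatom-above {n} {y} {z} z∈L z⊆y = by-cases (z ≟ₛ y)
  where
  above : Subset n → Bool
  above c = isYes (z ⊆? c)
  by-cases : Dec (z ≡ y) → (if any above (coatoms y) then + 0 else + 1) ≡ δ z y
  by-cases (yes refl) = trans
    (cong (λ b → if b then + 0 else + 1) (any-false above (coatoms z) λ {c} c∈ z⊆c →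
       let _ , c⊆z , c≢z , _ = ∈-coatoms⁻ z c∈ in c≢z (⊆-antisym c⊆z (toWitness {a? = z ⊆? c} z⊆c))))
    (sym (if-yes (z ≟ₛ z) refl))
  by-cases (no z≢y) with c , c∈ , z⊆c ← coatom-above y z∈L z⊆y z≢y = trans
    (cong (λ b → if b then + 0 else + 1) (any-true above c∈ (fromWitness {a? = z ⊆? c} z⊆c)))
    (sym (if-no (z ≟ₛ y) z≢y))

meetTerm : Subset n → Subset n → List (Subset n) → ℤ
meetTerm y x S = if does (x ≟ₛ meetFrom y S) then sign (length S) else + 0

-- Rota's crosscut formula, with the coatoms of y as crosscut.
crosscut : Subset n → Subset n → ℤ
crosscut x y = ∑ (sublists (coatoms y)) (meetTerm y x)

ζ∗crosscut≡δ : 1 ≤ n → {y z : Subset n} → y ∈ₗ Lₙ n → z ∈ₗ Lₙ n → z ⊆ y →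
  ∑[ w ∈ Lₙ n ] (if does (between? z y w) then crosscut w y else + 0) ≡ δ z y
ζ∗crosscut≡δ {n} 1≤n {y} {z} y∈L z∈L z⊆y = begin
  ∑[ w ∈ L ] (if does (between? z y w) then crosscut w y else + 0)
    ≡⟨ ∑-cong L (λ {w} _ → if-∑ (does (between? z y w)) Ss (meetTerm y w)) ⟩
  ∑[ w ∈ L ] ∑[ S ∈ Ss ] (if does (between? z y w) then meetTerm y w S else + 0)
    ≡⟨ ∑-comm L Ss _ ⟩
  ∑[ S ∈ Ss ] ∑[ w ∈ L ] (if does (between? z y w) then meetTerm y w S else + 0)
    ≡⟨ ∑-cong Ss (λ {S} S∈ → trans
         (∑-cong L (λ {w} _ → if-if-comm (does (between? z y w)) (does (w ≟ₛ meetFrom y S)) (sign (length S))))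
         (∑-indicator _≟ₛ_ L (meetFrom y S) (λ w → if does (between? z y w) then sign (length S) else + 0)
                      (Lₙ-unique n) (meet∈L S∈))) ⟩
  ∑[ S ∈ Ss ] (if does (between? z y (meetFrom y S)) then sign (length S) else + 0)
    ≡⟨ ∑-cong Ss (λ {S} _ → cong (λ b → if b then sign (length S) else + 0) (between-meetFrom S z⊆y)) ⟩
  ∑ Ss (signIfAll (λ c → isYes (z ⊆? c)))
    ≡⟨ ∑-sublists-alternating _ (coatoms y) ⟩
  (if any (λ c → isYes (z ⊆? c)) (coatoms y) then + 0 else + 1)
    ≡⟨ any-coatom-above z∈L z⊆y ⟩
  δ z y ∎
  where
  open ≡-Reasoning
  L = Lₙ n
  Ss = sublists (coatoms y)
  meet∈L : ∀ {S} → S ∈ₗ Ss → meetFrom y S ∈ₗ L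
  meet∈L {S} S∈ = meetFrom-∈Lₙ 1≤n y∈L S λ c∈S → proj₁ (∈-coatoms⁻ y (∈-sublists⇒⊆ (coatoms y) S∈ c∈S))

Separated : Subset n → List (Subset n) → Set
Separated {n} y l = ∀ {c} → c ∈ₗ l → Σ (Fin n) λ e → e ∈ y × e ∉ c × (∀ {c′} → c′ ∈ₗ l → c′ ≢ c → e ∈ c′)

meetTerm-∷ : (y x c : Subset n) (S : List (Subset n)) → meetTerm y x (c ∷ S) ≡ - meetTerm (c ∩ y) x S
meetTerm-∷ y x c S rewrite ∩-meetFrom c y S with x ≟ₛ meetFrom (c ∩ y) S
... | yes _ = sign-suc (length S)
... | no _  = refl

-- Distinct sublists of separated sets have distinct meets, so only one sublist contributes.
∑-meetTerm-separated : (y x : Subset n) (l : List (Subset n)) → Unique l → Separated y l →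
  ∑ (sublists l) (meetTerm y x) ≡ meetTerm y x (filter (x ⊆?_) l)
∑-meetTerm-separated y x []      _          _   = ℤ.+-identityʳ _
∑-meetTerm-separated y x (c ∷ l) (c∉l ∷ l!) sep = begin
  ∑ (sublists (c ∷ l)) (meetTerm y x)
    ≡⟨ ∑-sublists-∷ c l (meetTerm y x) ⟩
  (∑[ S ∈ sublists l ] meetTerm y x (c ∷ S)) + ∑ (sublists l) (meetTerm y x)
    ≡⟨ cong (_+ ∑ (sublists l) (meetTerm y x))
            (trans (∑-cong (sublists l) λ {S} _ → meetTerm-∷ y x c S)
                   (neg-distrib-∑ (sublists l) (meetTerm (c ∩ y) x))) ⟩
  - ∑ (sublists l) (meetTerm (c ∩ y) x) + ∑ (sublists l) (meetTerm y x)
    ≡⟨ cong₂ (λ s t → - s + t) (∑-meetTerm-separated (c ∩ y) x l l! sep-c∩y) (∑-meetTerm-separated y x l l! sep-y) ⟩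
  - meetTerm (c ∩ y) x F + meetTerm y x F
    ≡⟨ only-head-or-tail ⟩
  meetTerm y x (filter (x ⊆?_) (c ∷ l)) ∎
  where
  open ≡-Reasoning
  F = filter (x ⊆?_) l
  ≢c : ∀ {c′} → c′ ∈ₗ l → c′ ≢ c
  ≢c c′∈l refl = All.lookup c∉l c′∈l refl
  sep-y : Separated y l
  sep-y c′∈l with e , e∈y , e∉c′ , e∈others ← sep (there c′∈l) = e , e∈y , e∉c′ , λ c″∈l → e∈others (there c″∈l)
  sep-c∩y : Separated (c ∩ y) l
  sep-c∩y c′∈l with e , e∈y , e∉c′ , e∈others ← sep (there c′∈l) =
    e , x∈p∩q⁺ (e∈others (here refl) (≢c c′∈l ∘ sym) , e∈y) , e∉c′ , λ c″∈l → e∈others (there c″∈l)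
  F⊆l : ∀ {c′} → c′ ∈ₗ F → c′ ∈ₗ l
  F⊆l = proj₁ ∘ ∈-filter⁻ (x ⊆?_) {xs = l}
  only-head-or-tail : - meetTerm (c ∩ y) x F + meetTerm y x F ≡ meetTerm y x (filter (x ⊆?_) (c ∷ l))
  only-head-or-tail with x ⊆? c
  ... | yes x⊆c = begin
    - meetTerm (c ∩ y) x F + meetTerm y x F ≡⟨ cong (_+_ (- meetTerm (c ∩ y) x F)) (if-no (x ≟ₛ meetFrom y F) x≢meet) ⟩
    - meetTerm (c ∩ y) x F + + 0            ≡⟨ ℤ.+-identityʳ _ ⟩
    - meetTerm (c ∩ y) x F                  ≡⟨ sym (meetTerm-∷ y x c F) ⟩
    meetTerm y x (c ∷ F) ∎
    where
    x≢meet : x ≢ meetFrom y F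
    x≢meet x≡meet with e , e∈y , e∉c , e∈others ← sep (here refl) =
      e∉c (x⊆c (subst (e ∈_) (sym x≡meet) (∈-meetFrom⁺ y F e∈y λ c′∈F → e∈others (there (F⊆l c′∈F)) (≢c (F⊆l c′∈F)))))
  ... | no x⊈c = begin
    - meetTerm (c ∩ y) x F + meetTerm y x F
      ≡⟨ cong (λ t → - t + meetTerm y x F) (if-no (x ≟ₛ meetFrom (c ∩ y) F) x≢meet) ⟩
    + 0 + meetTerm y x F                    ≡⟨ ℤ.+-identityˡ _ ⟩
    meetTerm y x F ∎
    where
    x≢meet : x ≢ meetFrom (c ∩ y) F
    x≢meet x≡meet = x⊈c (subst (_⊆ c) (sym x≡meet) (⊆-trans (meetFrom-⊆ (c ∩ y) F) (p∩q⊆p c y)))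

-- Coatoms of an arithmetic progression

prime-dividing-prime : ∀ {p q} → Prime p → Prime q → q ∣ p → q ≡ p
prime-dividing-prime p-prime q-prime q∣p with prime⇒irreducible p-prime q∣p
... | inj₂ q≡p = q≡p
... | inj₁ refl = ⊥-elim (¬prime[1] q-prime)

*-positiveˡ : ∀ m {n} → 1 ≤ m * n → 1 ≤ m
*-positiveˡ m 1≤mn = >-nonZero⁻¹ m ⦃ m*n≢0⇒m≢0 m ⦃ >-nonZero 1≤mn ⦄ ⦄

prime>1 : ∀ {p} → Prime p → 1 < p
prime>1 {p} p-prime = nonTrivial⇒n>1 p ⦃ prime⇒nonTrivial p-prime ⦄

-- j is m with all its factors p divided out.
prime-free-part : ∀ {p} → Prime p → (m : ℕ) → 1 ≤ m → p ∣ m →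
  Σ ℕ λ j → 1 ≤ j × j < m × ¬ p ∣ j × (∀ {q} → Prime q → q ≢ p → q ∣ m → q ∣ j)
prime-free-part {p} p-prime = <-rec Free step
  where
  Free : ℕ → Set
  Free m = 1 ≤ m → p ∣ m → Σ ℕ λ j → 1 ≤ j × j < m × ¬ p ∣ j × (∀ {q} → Prime q → q ≢ p → q ∣ m → q ∣ j)
  step : ∀ m → (∀ {m′} → m′ < m → Free m′) → Free m
  step .(suc m₁ * p) smaller _ (divides (suc m₁) refl) = strip (p ∣? suc m₁)
    where
    m₁<m = m<m*n (suc m₁) p (prime>1 p-prime)
    ∣m⇒∣m₁ : ∀ {q} → Prime q → q ≢ p → q ∣ suc m₁ * p → q ∣ suc m₁
    ∣m⇒∣m₁ q-prime q≢p q∣m with euclidsLemma (suc m₁) p q-prime q∣m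
    ... | inj₁ q∣m₁ = q∣m₁
    ... | inj₂ q∣p  = ⊥-elim (q≢p (prime-dividing-prime p-prime q-prime q∣p))
    strip : Dec (p ∣ suc m₁) →
      Σ ℕ λ j → 1 ≤ j × j < suc m₁ * p × ¬ p ∣ j × (∀ {q} → Prime q → q ≢ p → q ∣ suc m₁ * p → q ∣ j)
    strip (no p∤m₁) = suc m₁ , s≤s z≤n , m₁<m , p∤m₁ , ∣m⇒∣m₁
    strip (yes p∣m₁) with j , 1≤j , j<m₁ , p∤j , ∣m₁⇒∣j ← smaller m₁<m (s≤s z≤n) p∣m₁ =
      j , 1≤j , <-trans j<m₁ m₁<m , p∤j , λ q-prime q≢p q∣m → ∣m₁⇒∣j q-prime q≢p (∣m⇒∣m₁ q-prime q≢p q∣m)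

-- y = {a, a + r, …, a + m r}; its coatoms drop the last element (init), drop the
-- first element (tail), or keep every p-th element for a prime p dividing m (stride p).
module ProgressionCoatoms {n a r m : ℕ} (1≤a : 1 ≤ a) (1≤r : 1 ≤ r)
  (bounded : ∀ j → j < suc m → a ℕ+ j * r ≤ n) where

  y init tail : Subset n
  y    = apSet n a r (suc m)
  init = apSet n a r m
  tail = apSet n (a ℕ+ r) r m

  stride : ℕ → ℕ → Subset n
  stride d i = apSet n a (d * r) (suc i)

  point : (t : ℕ) → t ≤ m → Fin n
  point t t≤m = fromValue (a ℕ+ t * r) (≤-trans 1≤a (m≤m+n a _)) (bounded t (s≤s t≤m))

  toℕ-point : ∀ t (t≤m : t ≤ m) → suc (toℕ (point t t≤m)) ≡ a ℕ+ t * r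
  toℕ-point t t≤m = toℕ-fromValue _ _ _

  point-unique : ∀ {i : Fin n} t (t≤m : t ≤ m) → suc (toℕ i) ≡ a ℕ+ t * r → i ≡ point t t≤m
  point-unique t t≤m i≡ = toℕ-injective (suc-injective (trans i≡ (sym (toℕ-point t t≤m))))

  point-irrelevant : ∀ t (p q : t ≤ m) → point t p ≡ point t q
  point-irrelevant t p q = point-unique t q (toℕ-point t p)

  first last : Fin n
  first = point 0 z≤n
  last  = point m ≤-refl

  ∈y⇒point : ∀ {i} → i ∈ y → Σ ℕ λ t → Σ (t ≤ m) λ t≤m → i ≡ point t t≤m
  ∈y⇒point i∈y with t , s≤s t≤m , i≡ ← ∈-apSet⁻ a r (suc m) i∈y = t , t≤m , point-unique t t≤m i≡

  point∈y : ∀ t (t≤m : t ≤ m) → point t t≤m ∈ y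
  point∈y t t≤m = ∈-apSet⁺ a r (suc m) t (s≤s t≤m) (toℕ-point t t≤m)

  point∈init : ∀ t (t≤m : t ≤ m) → t < m → point t t≤m ∈ init
  point∈init t t≤m t<m = ∈-apSet⁺ a r m t t<m (toℕ-point t t≤m)

  point∈tail : ∀ t (t≤m : t ≤ m) → 1 ≤ t → point t t≤m ∈ tail
  point∈tail (suc t) t≤m _ = ∈-apSet⁺ (a ℕ+ r) r m t t≤m (trans (toℕ-point (suc t) t≤m) (sym (+-assoc a r (t * r))))

  point∈stride : ∀ t (t≤m : t ≤ m) d i u → t ≡ u * d → u ≤ i → point t t≤m ∈ stride d i
  point∈stride t t≤m d i u t≡ud u≤i = ∈-apSet⁺ a (d * r) (suc i) u (s≤s u≤i)
    (trans (toℕ-point t t≤m) (trans (cong (λ s → a ℕ+ s * r) t≡ud) (cong (a ℕ+_) (*-assoc u d r))))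

  last∉init : last ∉ init
  last∉init last∈ with j , j<m , last≡ ← ∈-apSet⁻ a r m last∈ =
    <⇒≢ j<m (sym (index-injective a 1≤r (trans (sym (toℕ-point m ≤-refl)) last≡)))

  first∉tail : first ∉ tail
  first∉tail first∈ with j , _ , first≡ ← ∈-apSet⁻ (a ℕ+ r) r m first∈ =
    <⇒≱ (m<m+n a 1≤r) (≤-trans (m≤m+n (a ℕ+ r) (j * r))
                                (≤-reflexive (trans (sym first≡) (trans (toℕ-point 0 z≤n) (+-identityʳ a)))))

  point∉stride : ∀ t (t≤m : t ≤ m) d i → ¬ d ∣ t → point t t≤m ∉ stride d i
  point∉stride t t≤m d i d∤t point∈ with u , _ , point≡ ← ∈-apSet⁻ a (d * r) (suc i) point∈ =
    d∤t (divides u (index-injective a 1≤r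
      (trans (sym (toℕ-point t t≤m)) (trans point≡ (cong (a ℕ+_) (sym (*-assoc u d r)))))))

  init⊆y : init ⊆ y
  init⊆y i∈ with j , j<m , i≡ ← ∈-apSet⁻ a r m i∈ = ∈-apSet⁺ a r (suc m) j (m<n⇒m<1+n j<m) i≡

  tail⊆y : tail ⊆ y
  tail⊆y i∈ with j , j<m , i≡ ← ∈-apSet⁻ (a ℕ+ r) r m i∈ =
    ∈-apSet⁺ a r (suc m) (suc j) (s≤s j<m) (trans i≡ (+-assoc a r (j * r)))

  stride⊆y : ∀ d i → i * d ≤ m → stride d i ⊆ y
  stride⊆y d i id≤m i∈ with u , s≤s u≤i , i≡ ← ∈-apSet⁻ a (d * r) (suc i) i∈ =
    ∈-apSet⁺ a r (suc m) (u * d) (s≤s (≤-trans (*-monoˡ-≤ d u≤i) id≤m)) (trans i≡ (cong (a ℕ+_) (sym (*-assoc u d r))))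

  init≢y : init ≢ y
  init≢y init≡y = last∉init (subst (last ∈_) (sym init≡y) (point∈y m ≤-refl))

  tail≢y : tail ≢ y
  tail≢y tail≡y = first∉tail (subst (first ∈_) (sym tail≡y) (point∈y 0 z≤n))

  InL-init : InL n init
  InL-init = a , r , m , 1≤a , 1≤r , (λ j j<m → bounded j (m<n⇒m<1+n j<m)) , refl

  InL-tail : InL n tail
  InL-tail = a ℕ+ r , r , m , ≤-trans 1≤a (m≤m+n a r) , 1≤r ,
             (λ j j<m → subst (_≤ n) (sym (+-assoc a r (j * r))) (bounded (suc j) (s≤s j<m))) , refl

  InL-stride : ∀ d i → 1 ≤ d → i * d ≤ m → InL n (stride d i)
  InL-stride d i 1≤d id≤m = a , d * r , suc i , 1≤a , *-mono-≤ 1≤d 1≤r ,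
    (λ u u≤i → subst (_≤ n) (cong (a ℕ+_) (*-assoc u d r))
                             (bounded (u * d) (s≤s (≤-trans (*-monoˡ-≤ d (≤-pred u≤i)) id≤m)))) , refl

  stride-1≡y : ∀ i → i * 1 ≡ m → stride 1 i ≡ y
  stride-1≡y i i≡m = cong₂ (λ s k → apSet n a s (suc k)) (*-identityˡ r) (trans (sym (*-identityʳ i)) i≡m)

  stride-0≡y : ∀ d → 0 ≡ m → stride d 0 ≡ y
  stride-0≡y d refl = refl

  term-in-y : ∀ {a′ r′ k} → 1 ≤ a′ → (∀ j → j < k → a′ ℕ+ j * r′ ≤ n) → apSet n a′ r′ k ⊆ y →
    ∀ u → u < k → Σ ℕ λ t → t ≤ m × a′ ℕ+ u * r′ ≡ a ℕ+ t * r
  term-in-y {a′} {r′} {k} 1≤a′ bounded′ c⊆y u u<k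
    with e , e∈c , e≡ ← apSet-term a′ r′ k u 1≤a′ bounded′ u<k
    with t , s≤s t≤m , e≡′ ← ∈-apSet⁻ a r (suc m) (c⊆y e∈c)
    = t , t≤m , trans (sym e≡) e≡′

  starts-at-first : ∀ {a′ r′ k} → 1 ≤ a′ → (∀ j → j < suc k → a′ ℕ+ j * r′ ≤ n) → apSet n a′ r′ (suc k) ⊆ y →
    first ∈ apSet n a′ r′ (suc k) → a′ ≡ a
  starts-at-first {a′} {r′} {k} 1≤a′ bounded′ c⊆y first∈
    with j , _ , first≡ ← ∈-apSet⁻ a′ r′ (suc k) first∈
    with t , _ , a′≡ ← term-in-y 1≤a′ bounded′ c⊆y 0 (s≤s z≤n)
    = ≤-antisym (≤-trans (m≤m+n a′ (j * r′))
                         (≤-reflexive (trans (sym first≡) (trans (toℕ-point 0 z≤n) (+-identityʳ a)))))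
                (≤-trans (m≤m+n a (t * r)) (≤-reflexive (trans (sym a′≡) (+-identityʳ a′))))

  through-ends : {c : Subset n} → InL n c → c ⊆ y → first ∈ c → last ∈ c →
    Σ ℕ λ d → Σ ℕ λ i → 1 ≤ d × i * d ≡ m × c ≡ stride d i
  through-ends (a′ , r′ , zero , _ , _ , _ , refl) _ first∈ _ = ⊥-elim (∉-apSet-0 a′ r′ first∈)
  through-ends (a′ , r′ , suc k , 1≤a′ , 1≤r′ , bounded′ , refl) c⊆y first∈ last∈
    with refl ← starts-at-first 1≤a′ bounded′ c⊆y first∈
    with i , s≤s i≤k , last≡ ← ∈-apSet⁻ a r′ (suc k) last∈
    = thinned k i≤k (trans (sym (toℕ-point m ≤-refl)) last≡) bounded′ c⊆y
    where
    thinned : ∀ k → i ≤ k → a ℕ+ m * r ≡ a ℕ+ i * r′ → (∀ j → j < suc k → a ℕ+ j * r′ ≤ n) → apSet n a r′ (suc k) ⊆ y →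
      Σ ℕ λ d → Σ ℕ λ i → 1 ≤ d × i * d ≡ m × apSet n a r′ (suc k) ≡ stride d i
    thinned zero z≤n m≡0 _ _ = 1 , 0 , ≤-refl , sym (index-injective a 1≤r m≡0) , refl
    thinned (suc k₀) i≤k last≡ bounded″ c⊆y′
      with d , _ , second≡ ← term-in-y 1≤a bounded″ c⊆y′ 1 (s≤s (s≤s z≤n))
      with t , t≤m , final≡ ← term-in-y 1≤a bounded″ c⊆y′ (suc k₀) ≤-refl
      = d , suc k₀ , 1≤d , trans (cong (_* d) (sym i≡k)) (sym m≡id) , cong (λ s → apSet n a s (suc (suc k₀))) r′≡dr
      where
      r′≡dr : r′ ≡ d * r
      r′≡dr = trans (sym (*-identityˡ r′)) (+-cancelˡ-≡ a _ _ second≡)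
      1≤d : 1 ≤ d
      1≤d = *-positiveˡ d (subst (1 ≤_) r′≡dr 1≤r′)
      thin : ∀ j → a ℕ+ j * r′ ≡ a ℕ+ (j * d) * r
      thin j = cong (a ℕ+_) (trans (cong (j *_) r′≡dr) (sym (*-assoc j d r)))
      m≡id : m ≡ i * d
      m≡id = index-injective a 1≤r (trans last≡ (thin i))
      i≡k : i ≡ suc k₀
      i≡k = ≤-antisym i≤k (*-cancelʳ-≤ (suc k₀) i d ⦃ >-nonZero 1≤d ⦄
              (≤-trans (≤-reflexive (index-injective a 1≤r (trans (sym (thin (suc k₀))) final≡)))
                       (≤-trans t≤m (≤-reflexive m≡id))))

  data Kind (c : Subset n) : Set where
    isInit   : c ≡ init → Kind c
    isTail   : c ≡ tail → Kind c
    isStride : ∀ p i → Prime p → 1 ≤ i → i * p ≡ m → c ≡ stride p i → Kind c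

  covered-below : {c z : Subset n} → CoveredBy n y c → InL n z → c ⊆ z → z ⊆ y → z ≢ y → z ≡ c
  covered-below (_ , _ , _ , trivial) InLz c⊆z z⊆y z≢y = [ id , ⊥-elim ∘ z≢y ]′ (trivial _ InLz c⊆z z⊆y)

  stride-⊆ : ∀ {d e f} i → d ≡ f * e → stride d i ⊆ stride e (i * f)
  stride-⊆ {d} {e} {f} i d≡fe j∈ with u , s≤s u≤i , j≡ ← ∈-apSet⁻ a (d * r) (suc i) j∈ =
    ∈-apSet⁺ a (e * r) (suc (i * f)) (u * f) (s≤s (*-monoˡ-≤ f u≤i))
      (trans j≡ (cong (a ℕ+_) (trans (cong (λ s → u * (s * r)) d≡fe)
        (trans (cong (u *_) (*-assoc f e r)) (sym (*-assoc u f (e * r)))))))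

  -- A proper divisor e of d gives stride e, lying strictly between stride d and y.
  composite-stride-not-covered : ∀ {d i} → 1 < d → ¬ Prime d → 1 ≤ i → i * d ≡ m → ¬ CoveredBy n y (stride d i)
  composite-stride-not-covered {d} {i} 1<d ¬prime 1≤i id≡m cov
    with hasNonTrivialDivisor {e} ⦃ e-nontrivial ⦄ e<d (divides f d≡fe) ← ¬prime⇒composite ⦃ n>1⇒nonTrivial 1<d ⦄ ¬prime
    = z≢c (covered-below cov (InL-stride e (i * f) 1≤e (≤-reflexive ife≡m)) (stride-⊆ i d≡fe)
                             (stride⊆y e (i * f) (≤-reflexive ife≡m)) z≢y)
    where
    1<e = nonTrivial⇒n>1 e ⦃ e-nontrivial ⦄
    1≤e = <⇒≤ 1<e
    ife≡m : i * f * e ≡ m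
    ife≡m = trans (*-assoc i f e) (trans (cong (i *_) (sym d≡fe)) id≡m)
    1≤f : 1 ≤ f
    1≤f = *-positiveˡ f (subst (1 ≤_) d≡fe (<⇒≤ 1<d))
    d≤m : d ≤ m
    d≤m = ≤-trans (m≤n*m d i ⦃ >-nonZero 1≤i ⦄) (≤-reflexive id≡m)
    e≤m = ≤-trans (<⇒≤ e<d) d≤m
    1≤m = ≤-trans (<⇒≤ 1<d) d≤m
    z≢c : stride e (i * f) ≢ stride d i
    z≢c z≡c = point∉stride e e≤m d i (λ d∣e → <⇒≱ e<d (∣⇒≤ ⦃ >-nonZero 1≤e ⦄ d∣e))
      (subst (point e e≤m ∈_) z≡c (point∈stride e e≤m e (i * f) 1 (sym (*-identityˡ e)) (*-mono-≤ 1≤i 1≤f)))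
    z≢y : stride e (i * f) ≢ y
    z≢y z≡y = point∉stride 1 1≤m e (i * f) (λ e∣1 → <⇒≢ 1<e (sym (∣1⇒≡1 e∣1)))
      (subst (point 1 1≤m ∈_) (sym z≡y) (point∈y 1 1≤m))

  classify-stride : ∀ d i → 1 ≤ d → i * d ≡ m → CoveredBy n y (stride d i) → Kind (stride d i)
  classify-stride 1 i _ i1≡m (_ , _ , c≢y , _) = ⊥-elim (c≢y (stride-1≡y i i1≡m))
  classify-stride (suc (suc d₀)) zero _ 0≡m (_ , _ , c≢y , _) = ⊥-elim (c≢y (stride-0≡y (suc (suc d₀)) 0≡m))
  classify-stride (suc (suc d₀)) (suc i₀) _ id≡m cov with prime? (suc (suc d₀))
  ... | yes prime-d = isStride (suc (suc d₀)) (suc i₀) prime-d (s≤s z≤n) id≡m refl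
  ... | no ¬prime-d =
    ⊥-elim (composite-stride-not-covered {suc (suc d₀)} {suc i₀} (s≤s (s≤s z≤n)) ¬prime-d (s≤s z≤n) id≡m cov)

  classify : {c : Subset n} → CoveredBy n y c → Kind c
  classify {c} cov@(InLc , c⊆y , c≢y , _) with first ∈? c | last ∈? c
  ... | no first∉c | _ = isTail (sym (covered-below cov InL-tail c⊆tail tail⊆y tail≢y))
    where
    c⊆tail : c ⊆ tail
    c⊆tail i∈c with t , t≤m , refl ← ∈y⇒point (c⊆y i∈c) with t
    ... | zero  = ⊥-elim (first∉c (subst (_∈ c) (point-irrelevant 0 t≤m z≤n) i∈c))
    ... | suc _ = point∈tail _ t≤m (s≤s z≤n)
  ... | yes _ | no last∉c = isInit (sym (covered-below cov InL-init c⊆init init⊆y init≢y))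
    where
    c⊆init : c ⊆ init
    c⊆init i∈c with t , t≤m , refl ← ∈y⇒point (c⊆y i∈c) with m≤n⇒m<n∨m≡n t≤m
    ... | inj₁ t<m = point∈init t t≤m t<m
    ... | inj₂ refl = ⊥-elim (last∉c (subst (_∈ c) (point-irrelevant m t≤m ≤-refl) i∈c))
  ... | yes first∈c | yes last∈c with d , i , 1≤d , id≡m , refl ← through-ends InLc c⊆y first∈c last∈c =
    classify-stride d i 1≤d id≡m cov

  init≡tail : m ≡ 0 → init ≡ tail
  init≡tail m≡0 =
    ⊆-antisym (λ i∈ → ⊥-elim (empty (∈-apSet⁻ a r m i∈))) (λ i∈ → ⊥-elim (empty (∈-apSet⁻ (a ℕ+ r) r m i∈)))
    where
    empty : ∀ {A : ℕ → Set} → Σ ℕ (λ j → j < m × A j) → ⊥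
    empty (j , j<m , _) = <⇒≱ j<m (≤-trans (≤-reflexive m≡0) z≤n)

  Separating : Subset n → Fin n → Set
  Separating c e = e ∈ y × e ∉ c × (∀ {c′} → CoveredBy n y c′ → c′ ≢ c → e ∈ c′)

  init-separated : Separating init last
  init-separated = point∈y m ≤-refl , last∉init , elsewhere
    where
    elsewhere : ∀ {c′} → CoveredBy n y c′ → c′ ≢ init → last ∈ c′
    elsewhere cov c′≢init with classify cov
    ... | isInit refl = ⊥-elim (c′≢init refl)
    ... | isTail refl with 0 <? m
    ...   | yes 1≤m = point∈tail m ≤-refl 1≤m
    ...   | no m≯0  = ⊥-elim (c′≢init (sym (init≡tail (n≤0⇒n≡0 (≮⇒≥ m≯0)))))
    elsewhere cov c′≢init | isStride q i′ _ _ i′q≡m refl = point∈stride m ≤-refl q i′ i′ (sym i′q≡m) ≤-refl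

  tail-separated : Separating tail first
  tail-separated = point∈y 0 z≤n , first∉tail , elsewhere
    where
    elsewhere : ∀ {c′} → CoveredBy n y c′ → c′ ≢ tail → first ∈ c′
    elsewhere cov c′≢tail with classify cov
    ... | isTail refl = ⊥-elim (c′≢tail refl)
    ... | isInit refl with 0 <? m
    ...   | yes 1≤m = point∈init 0 z≤n 1≤m
    ...   | no m≯0  = ⊥-elim (c′≢tail (init≡tail (n≤0⇒n≡0 (≮⇒≥ m≯0))))
    elsewhere cov c′≢tail | isStride q i′ _ _ _ refl = point∈stride 0 z≤n q i′ 0 refl z≤n

  -- The separating element of stride p is a + j r, j being the part of m prime to p.
  stride-separated : ∀ {p i} → Prime p → 1 ≤ i → i * p ≡ m → Σ (Fin n) (Separating (stride p i))
  stride-separated {p} {i} p-prime 1≤i ip≡m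
    with j , 1≤j , j<m , p∤j , ∣m⇒∣j ← prime-free-part p-prime m
           (subst (1 ≤_) ip≡m (*-mono-≤ 1≤i (<⇒≤ (prime>1 p-prime)))) (divides i (sym ip≡m))
    = point j j≤m , point∈y j j≤m , point∉stride j j≤m p i p∤j , elsewhere
    where
    j≤m = <⇒≤ j<m
    elsewhere : ∀ {c′} → CoveredBy n y c′ → c′ ≢ stride p i → point j j≤m ∈ c′
    elsewhere cov c′≢c with classify cov
    ... | isInit refl = point∈init j j≤m j<m
    ... | isTail refl = point∈tail j j≤m 1≤j
    ... | isStride q i′ q-prime _ i′q≡m refl with q ≟ p
    ...   | yes refl =
      ⊥-elim (c′≢c (cong (stride p) (*-cancelʳ-≡ i′ i p ⦃ prime⇒nonZero p-prime ⦄ (trans i′q≡m (sym ip≡m)))))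
    ...   | no q≢p with divides u j≡uq ← ∣m⇒∣j q-prime q≢p (divides i′ (sym i′q≡m)) =
      point∈stride j j≤m q i′ u j≡uq
        (*-cancelʳ-≤ u i′ q ⦃ prime⇒nonZero q-prime ⦄
                     (≤-trans (≤-reflexive (sym j≡uq)) (≤-trans j≤m (≤-reflexive (sym i′q≡m)))))

  separated : {c : Subset n} → CoveredBy n y c → Σ (Fin n) (Separating c)
  separated cov with classify cov
  ... | isInit refl = last , init-separated
  ... | isTail refl = first , tail-separated
  ... | isStride p i p-prime 1≤i ip≡m refl = stride-separated p-prime 1≤i ip≡m

coatom⇒CoveredBy : 1 ≤ n → {y c : Subset n} → c ∈ₗ coatoms y → CoveredBy n y c
coatom⇒CoveredBy 1≤n {y} c∈ with c∈L , c⊆y , c≢y , trivial ← ∈-coatoms⁻ y c∈ =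
  ∈Lₙ⇒InL c∈L , c⊆y , c≢y , λ z InLz → All.lookup trivial (InL⇒∈Lₙ 1≤n InLz)

CoveredBy⇒coatom : 1 ≤ n → {y c : Subset n} → CoveredBy n y c → c ∈ₗ coatoms y
CoveredBy⇒coatom 1≤n {y} (InLc , c⊆y , c≢y , trivial) =
  ∈-filter⁺ (isCoatom? y) (InL⇒∈Lₙ 1≤n InLc) (c⊆y , c≢y , All.tabulate λ {z} z∈L → trivial z (∈Lₙ⇒InL z∈L))

coatoms-separated : 1 ≤ n → {y : Subset n} → InL n y → Separated y (coatoms y)
coatoms-separated 1≤n (a , r , zero , _ , _ , _ , refl) c∈
  with _ , c⊆y , c≢y , _ ← ∈-coatoms⁻ _ c∈ = ⊥-elim (c≢y (⊆-antisym c⊆y λ i∈ → ⊥-elim (∉-apSet-0 a r i∈)))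
coatoms-separated 1≤n (a , r , suc m , 1≤a , 1≤r , bounded , refl) c∈
  with e , e∈y , e∉c , elsewhere ← ProgressionCoatoms.separated 1≤a 1≤r bounded (coatom⇒CoveredBy 1≤n c∈)
  = e , e∈y , e∉c , λ c′∈ c′≢c → elsewhere (coatom⇒CoveredBy 1≤n c′∈) c′≢c

-- By separation, a list of distinct coatoms with meet x must list exactly the coatoms above x.
meet-of-coatoms : 1 ≤ n → {x y : Subset n} → InL n y → (cs : List (Subset n)) → Unique cs →
  All (CoveredBy n y) cs → meetFrom y cs ≡ x →
  meetFrom y (filter (x ⊆?_) (coatoms y)) ≡ x × length (filter (x ⊆?_) (coatoms y)) ≡ length cs
meet-of-coatoms 1≤n {x} {y} InLy cs cs! cs-covered refl =
  ⊆-antisym (⊆-meetFrom y cs (meetFrom-⊆ y F) (meetFrom-⊆-∈ y F ∘ cs⊆F)) (⊆-meetFrom y F (meetFrom-⊆ y cs) F-above) ,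
  length-cong-unique (UniqueP.filter⁺ (x ⊆?_) (coatoms-unique y)) cs! F⊆cs cs⊆F
  where
  F = filter (x ⊆?_) (coatoms y)
  F-above : ∀ {c} → c ∈ₗ F → x ⊆ c
  F-above = proj₂ ∘ ∈-filter⁻ (x ⊆?_) {xs = coatoms y}
  cs⊆F : ∀ {c} → c ∈ₗ cs → c ∈ₗ F
  cs⊆F c∈cs = ∈-filter⁺ (x ⊆?_) (CoveredBy⇒coatom 1≤n (All.lookup cs-covered c∈cs)) (meetFrom-⊆-∈ y cs c∈cs)
  F⊆cs : ∀ {c} → c ∈ₗ F → c ∈ₗ cs
  F⊆cs {c} c∈F with DecMembership._∈?_ _≟ₛ_ c cs
  ... | yes c∈cs = c∈cs
  ... | no c∉cs
    with e , e∈y , e∉c , e∈others ← coatoms-separated 1≤n InLy (proj₁ (∈-filter⁻ (x ⊆?_) {xs = coatoms y} c∈F)) =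
    ⊥-elim (e∉c (F-above c∈F (∈-meetFrom⁺ y cs e∈y λ {c′} c′∈cs →
      e∈others (CoveredBy⇒coatom 1≤n (All.lookup cs-covered c′∈cs)) λ { refl → c∉cs c′∈cs })))

μ≡meetTerm : 1 ≤ n → {x y : Subset n} → InL n x → InL n y → x ⊆ y →
  μ n x y ≡ meetTerm y x (filter (x ⊆?_) (coatoms y))
μ≡meetTerm {n} 1≤n {x} {y} InLx InLy x⊆y = begin
  μ n x y       ≡⟨ μ-unique crosscut y∈L (ζ∗crosscut≡δ 1≤n y∈L) (InL⇒∈Lₙ 1≤n InLx) x⊆y ⟩
  crosscut x y  ≡⟨ ∑-meetTerm-separated y x (coatoms y) (coatoms-unique y) (coatoms-separated 1≤n InLy) ⟩
  meetTerm y x (filter (x ⊆?_) (coatoms y)) ∎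
  where
  open ≡-Reasoning
  y∈L = InL⇒∈Lₙ 1≤n InLy

corollary8 : (n : ℕ) → 1 ≤ n → (x₁ x₂ : Subset n) → InL n x₁ → InL n x₂ → x₁ ⊆ x₂ →
    ((cs : List (Subset n)) → Unique cs → All (CoveredBy n x₂) cs →
        meetFrom x₂ cs ≡ x₁ → μ n x₁ x₂ ≡ sign (length cs))
    × (((cs : List (Subset n)) → Unique cs → All (CoveredBy n x₂) cs →
        meetFrom x₂ cs ≢ x₁) → μ n x₁ x₂ ≡ + 0)
corollary8 n 1≤n x₁ x₂ InLx₁ InLx₂ x₁⊆x₂ = meet-of-k-coatoms , not-a-meet
  where
  F = filter (x₁ ⊆?_) (coatoms x₂)
  meet-of-k-coatoms : (cs : List (Subset n)) → Unique cs → All (CoveredBy n x₂) cs →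
    meetFrom x₂ cs ≡ x₁ → μ n x₁ x₂ ≡ sign (length cs)
  meet-of-k-coatoms cs cs! cs-covered meet≡x₁
    with meetF≡x₁ , |F|≡|cs| ← meet-of-coatoms 1≤n InLx₂ cs cs! cs-covered meet≡x₁ = begin
    μ n x₁ x₂         ≡⟨ μ≡meetTerm 1≤n InLx₁ InLx₂ x₁⊆x₂ ⟩
    meetTerm x₂ x₁ F  ≡⟨ if-yes (x₁ ≟ₛ meetFrom x₂ F) (sym meetF≡x₁) ⟩
    sign (length F)   ≡⟨ cong sign |F|≡|cs| ⟩
    sign (length cs)  ∎
    where open ≡-Reasoning
  not-a-meet : ((cs : List (Subset n)) → Unique cs → All (CoveredBy n x₂) cs → meetFrom x₂ cs ≢ x₁) →
    μ n x₁ x₂ ≡ + 0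
  not-a-meet no-meet = trans (μ≡meetTerm 1≤n InLx₁ InLx₂ x₁⊆x₂) (if-no (x₁ ≟ₛ meetFrom x₂ F)
    (no-meet F (UniqueP.filter⁺ (x₁ ⊆?_) (coatoms-unique x₂))
               (All.tabulate (coatom⇒CoveredBy 1≤n ∘ proj₁ ∘ ∈-filter⁻ (x₁ ⊆?_) {xs = coatoms x₂})) ∘ sym))
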